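{- Let $(G,S,k,r)$ be an instance of Disjoint $r$-pseudoforest Deletion. Suppose there is a vertex $u \in V(G)\setminus S$ of degree two such that at least one neighbor of $u$ lies in $V(G)\setminus S$. Let $G'$ be obtained from $G$ by deleting $u$ and adding a new edge between the two neighbors of $u$ (even if they are already adjacent); if both edges incident to $u$ go to the same vertex, $G'$ is obtained by deleting $u$ and adding a new loop at that vertex (even if it already has loops). Then $(G,S,k,r)$ is a yes-instance if and only if $(G',S,k,r)$ is a yes-instance.
   Context: Graphs may have parallel edges and loops; the degree of a vertex is the number of edges incident with it. An $r$-pseudoforest is a graph in which each connected component can be made into a forest by deleting at most $r$ edges (a loop or a pair of parallel edges counts as a cycle). A set $S \subseteq V(G)$ is an $r$-pseudoforest deletion set if $G - S$ is an $r$-pseudoforest. Disjoint $r$-pseudoforest Deletion: the input is a graph $G$, integers $k$ and $r$, and an $r$-pseudoforest deletion set $S$ of $G$ with $|S| \le k+1$; the instance is a yes-instance iff there exists an $r$-pseudoforest deletion set $X$ of $G$ with $|X| \le k$ and $X \cap S = \emptyset$. -}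

module Defs where

open import Data.Nat using (ℕ; zero; suc; _≤_; _<_; _<?_)
open import Data.Bool using (Bool; true; false; _∨_)
open import Data.Fin using (Fin; zero; suc; toℕ; fromℕ<; punchOut; punchIn; _≟_)
open import Data.Fin.Subset using (Subset; _∈_; _∉_; ∣_∣)
open import Data.List using (List; []; _∷_; length; lookup; _++_; [_])
open import Data.Vec using (tabulate)
import Data.Vec as Vec
open import Data.Product using (Σ; ∃; _×_; _,_; proj₁; proj₂)
open import Data.Sum using (_⊎_)
open import Data.Unit using (⊤)
open import Relation.Nullary using (¬_; yes; no)
open import Relation.Nullary.Decidable using (isYes)
open import Relation.Binary.PropositionalEquality using (_≡_; _≢_)
open import Function.Definitions using (Injective)

-- Loops (x , x) and parallel edges (repeated entries) are allowed.
-- Edges are identified by their position in the list.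
Graph : ℕ → Set
Graph n = List (Fin n × Fin n)

Edge : ∀ {n} → Graph n → Set
Edge G = Fin (length G)

ends : ∀ {n} (G : Graph n) → Edge G → Fin n × Fin n
ends G e = lookup G e

Joins : ∀ {n} (G : Graph n) → Edge G → Fin n → Fin n → Set
Joins G e x y = ends G e ≡ (x , y) ⊎ ends G e ≡ (y , x)

incident? : ∀ {n} (G : Graph n) → Fin n → Edge G → Bool
incident? G v e = isYes (proj₁ (ends G e) ≟ v) ∨ isYes (proj₂ (ends G e) ≟ v)

degree : ∀ {n} (G : Graph n) → Fin n → ℕ
degree G v = ∣ tabulate (incident? G v) ∣

data Reach {n} (G : Graph n) (W : Fin n → Set) (A : Edge G → Set) : Fin n → Fin n → Set where
  here : ∀ {v} → Reach G W A v v
  step : ∀ {x y z} (e : Edge G) → A e → W x → W y → Joins G e x y →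
         Reach G W A y z → Reach G W A x z

csuc : ∀ {k} → Fin (suc k) → Fin (suc k)
csuc {k} i with suc (toℕ i) <? suc k
... | yes p = fromℕ< p
... | no _ = zero

-- Length 1 = loop, length 2 = pair of parallel edges.
record Cycle {n} (G : Graph n) (W : Fin n → Set) (A : Edge G → Set) : Set where
  field
    len    : ℕ
    vs     : Fin (suc len) → Fin n
    es     : Fin (suc len) → Edge G
    vs-inj : Injective _≡_ _≡_ vs
    es-inj : Injective _≡_ _≡_ es
    vs-in  : ∀ i → W (vs i)
    es-in  : ∀ i → A (es i)
    joins  : ∀ i → Joins G (es i) (vs i) (vs (csuc i))

AllEdges : ∀ {n} (G : Graph n) → Edge G → Set
AllEdges G e = ⊤

InComp : ∀ {n} (G : Graph n) (W : Fin n → Set) → Fin n → Fin n → Set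
InComp G W v w = W w × Reach G W (AllEdges G) v w

IsRPseudoforest : ∀ {n} (G : Graph n) (r : ℕ) (W : Fin n → Set) → Set
IsRPseudoforest G r W =
  ∀ v → W v →
  Σ (Subset (length G)) λ F →
    ∣ F ∣ ≤ r ×
    (∀ e → e ∈ F → InComp G W v (proj₁ (ends G e)) × InComp G W v (proj₂ (ends G e))) ×
    ¬ Cycle G (InComp G W v) (λ e → e ∉ F)

IsRPFDeletionSet : ∀ {n} (G : Graph n) (r : ℕ) (X : Subset n) → Set
IsRPFDeletionSet G r X = IsRPseudoforest G r (λ v → v ∉ X)

YesInstance : ∀ {n} (G : Graph n) (S : Subset n) (k r : ℕ) → Set
YesInstance {n} G S k r =
  Σ (Subset n) λ X → IsRPFDeletionSet G r X × ∣ X ∣ ≤ k × (∀ v → v ∈ X → v ∉ S)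

deleteVertex : ∀ {n} (u : Fin (suc n)) → Graph (suc n) → Graph n
deleteVertex u [] = []
deleteVertex u ((x , y) ∷ es) with u ≟ x | u ≟ y
... | no u≢x | no u≢y = (punchOut u≢x , punchOut u≢y) ∷ deleteVertex u es
... | _ | _ = deleteVertex u es

bypass : ∀ {n} (G : Graph (suc n)) (u a b : Fin (suc n)) → u ≢ a → u ≢ b → Graph n
bypass G u a b u≢a u≢b = deleteVertex u G ++ [ (punchOut u≢a , punchOut u≢b) ]

-- the set S viewed in G - u (vertex v of G - u is punchIn u v in G)
restrict : ∀ {n} (u : Fin (suc n)) → Subset (suc n) → Subset n
restrict u S = tabulate (λ v → Vec.lookup S (punchIn u v))

module Submission where

-- Let H = bypass G u a b be G with the degree-two vertex u removed and a new
-- edge ν joining its neighbours a and b.  The vertices of H are those of G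
-- other than u, embedded by ι = punchIn u.  Call vertex sets WG ⊆ V(G) and
-- WH ⊆ V(H) matching when they agree on V(G) - u.
--
-- * Walks: for matching sets in which u is present or one of a, b is absent,
--   ι x and ι y are connected in G[WG] iff x and y are connected in H[WH];
--   the walk a-u-b of G plays the role of the edge ν of H.
-- * Cycles, handled as rotatable cyclic lists of (vertex, edge) pairs:
--   replacing ν by the two edges e₁, e₂ at u turns a cycle of H into a cycle
--   of G; conversely a cycle of G through u uses both e₁ and e₂ (u has degree
--   two), and shortcutting u yields a cycle of H through ν.
-- * Hence the edge sets whose removal makes components forests correspond
--   (ν ↔ {e₁, e₂}), and being an r-pseudoforest transfers between G[WG] and
--   H[WH] in both directions (the direction H → G needs u ∈ WG).
-- * A solution X of G restricts to H; when u ∈ X we first add the neighbour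
--   c ∈ {a, b} outside S, which kills ν and is harmless because induced
--   subgraphs of r-pseudoforests are r-pseudoforests.  A solution of H lifts
--   to G by keeping u.

open import Defs
open import Data.Nat using (ℕ; zero; suc; _+_; _≤_; _<_; z≤n; s≤s; s≤s⁻¹; _<?_)
open import Data.Nat.Properties
  using (≤-refl; ≤-trans; ≤-reflexive; <-irrefl; +-comm; +-assoc; +-mono-≤; m≤n+m; module ≤-Reasoning)
open import Data.Bool using (Bool; true; false; _∨_; _∧_)
open import Data.Bool.Properties
  using (∧-identityʳ; ∧-zeroʳ; ∧-conicalˡ; ∧-conicalʳ; ∨-identityʳ; ∨-zeroʳ; ∨-conicalˡ; ∨-conicalʳ)
open import Data.Fin
  using (Fin; zero; suc; toℕ; fromℕ; inject₁; punchIn; punchOut; _≟_)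
open import Data.Fin.Properties
  using ( toℕ-injective; toℕ-inject₁; toℕ-fromℕ; toℕ-fromℕ<; toℕ<n; suc-injective
        ; punchIn-punchOut; punchOut-injective; punchInᵢ≢i; punchIn-injective
        ; injective⇒≤; any?)
open import Data.Fin.Subset using (Subset; _∈_; _∉_; ∣_∣) renaming (⊥ to ∅)
open import Data.Fin.Subset.Properties using (∉⊥; ∣⊥∣≡0; _∈?_)
open import Data.Vec using (tabulate; lookup; insertAt)
open import Data.Vec.Properties
  using (tabulate∘lookup; []=⇒lookup; lookup⇒[]=; lookup∘tabulate; insertAt-lookup; insertAt-punchIn)
open import Data.List using (List; []; _∷_; length; map; _++_; [_]; initLast; _∷ʳ′_)
import Data.List as List
open import Data.List.Properties using (map-++; ++-assoc; ++-identityʳ; map-id; map-∘; map-tabulate)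
open import Data.List.Relation.Unary.All using (All; []; _∷_)
import Data.List.Relation.Unary.All as All
import Data.List.Relation.Unary.All.Properties as AllP
open import Data.List.Relation.Unary.Any using (Any; here; there)
open import Data.List.Relation.Unary.AllPairs using ([]; _∷_)
open import Data.List.Relation.Unary.Unique.Propositional using (Unique)
import Data.List.Relation.Unary.Unique.Propositional.Properties as UniqueP
open import Data.Product using (Σ; _×_; _,_; proj₁; proj₂)
open import Data.Product.Properties using (,-injective; ≡-dec)
open import Data.Sum using (_⊎_; inj₁; inj₂; [_,_]′) renaming (map to ⊎-map; map₂ to ⊎-map₂)
open import Data.Empty using (⊥; ⊥-elim)
open import Data.Unit using (tt)
open import Function using (_∘_; id)
open import Function.Bundles using (_⇔_; mk⇔)
open import Relation.Nullary using (¬_; Dec; yes; no)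
open import Relation.Nullary.Decidable
  using (isYes; isYes≗does; dec-true; dec-false; _×-dec_; _⊎-dec_; map′; ¬?)
open import Relation.Binary.PropositionalEquality
  using (_≡_; _≢_; refl; sym; trans; cong; cong₂; subst; subst₂)

∧-true : ∀ x y → x ∧ y ≡ true → x ≡ true × y ≡ true
∧-true x y h = ∧-conicalˡ x y h , ∧-conicalʳ x y h

∨-true : ∀ x y → x ∨ y ≡ true → x ≡ true ⊎ y ≡ true
∨-true true  y h = inj₁ refl
∨-true false y h = inj₂ h

∨-false : ∀ x y → x ∨ y ≡ false → x ≡ false × y ≡ false
∨-false x y h = ∨-conicalˡ x y h , ∨-conicalʳ x y h

isYes-true : ∀ {P : Set} (d : Dec P) → P → isYes d ≡ true
isYes-true d p = trans (isYes≗does d) (dec-true d p)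

isYes-false : ∀ {P : Set} (d : Dec P) → ¬ P → isYes d ≡ false
isYes-false d ¬p = trans (isYes≗does d) (dec-false d ¬p)

isYes-sound : ∀ {P : Set} (d : Dec P) → isYes d ≡ true → P
isYes-sound (yes p) _ = p

module _ {m : ℕ} {p : Subset m} {x : Fin m} where

  ∈⇒true : x ∈ p → lookup p x ≡ true
  ∈⇒true = []=⇒lookup

  true⇒∈ : lookup p x ≡ true → x ∈ p
  true⇒∈ = lookup⇒[]= x p

  false⇒∉ : lookup p x ≡ false → x ∉ p
  false⇒∉ h x∈p with trans (sym (∈⇒true x∈p)) h
  ... | ()

  ∉⇒false : x ∉ p → lookup p x ≡ false
  ∉⇒false x∉p with lookup p x in eq
  ... | true  = ⊥-elim (x∉p (true⇒∈ eq))
  ... | false = refl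

-- Cardinalities
-- of edge sets of G, of G - u and of the bypass graph are compared through
-- this, by splitting the count along how the edges correspond.

bit : Bool → ℕ
bit true  = 1
bit false = 0

count : ∀ {m} → (Fin m → Bool) → ℕ
count {zero}  f = 0
count {suc m} f = bit (f zero) + count (f ∘ suc)

∣tabulate∣≡count : ∀ {m} (f : Fin m → Bool) → ∣ tabulate f ∣ ≡ count f
∣tabulate∣≡count {zero}  f = refl
∣tabulate∣≡count {suc m} f with f zero
... | true  = cong suc (∣tabulate∣≡count (f ∘ suc))
... | false = ∣tabulate∣≡count (f ∘ suc)

∣∣≡count : ∀ {m} (p : Subset m) → ∣ p ∣ ≡ count (lookup p)
∣∣≡count p = trans (cong ∣_∣ (sym (tabulate∘lookup p))) (∣tabulate∣≡count (lookup p))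

count-cong : ∀ {m} {f g : Fin m → Bool} → (∀ i → f i ≡ g i) → count f ≡ count g
count-cong {zero}  h = refl
count-cong {suc m} h = cong₂ _+_ (cong bit (h zero)) (count-cong (h ∘ suc))

bit-mono : ∀ {x y} → (x ≡ true → y ≡ true) → bit x ≤ bit y
bit-mono {false} h = z≤n
bit-mono {true}  h rewrite h refl = ≤-refl

count-mono : ∀ {m} {f g : Fin m → Bool} → (∀ i → f i ≡ true → g i ≡ true) → count f ≤ count g
count-mono {zero}  h = z≤n
count-mono {suc m} h = +-mono-≤ (bit-mono (h zero)) (count-mono (h ∘ suc))

+-exchange : ∀ x y z → x + (y + z) ≡ y + (x + z)
+-exchange x y z = trans (sym (+-assoc x y z)) (trans (cong (_+ z) (+-comm x y)) (+-assoc y x z))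

count-split : ∀ {m} (f : Fin (suc m) → Bool) (i : Fin (suc m)) →
  count f ≡ bit (f i) + count (f ∘ punchIn i)
count-split f zero = refl
count-split {suc m} f (suc i) =
  trans (cong (bit (f zero) +_) (count-split (f ∘ suc) i))
        (+-exchange (bit (f zero)) (bit (f (suc i))) _)

count-pos : ∀ {m} (f : Fin m → Bool) i → f i ≡ true → 1 ≤ count f
count-pos {suc m} f i h rewrite count-split f i | h = s≤s z≤n

bit≤count : ∀ {m} (x : Bool) (f : Fin m → Bool) → (x ≡ true → Σ (Fin m) λ i → f i ≡ true) → bit x ≤ count f
bit≤count false f w = z≤n
bit≤count true  f w = count-pos f (proj₁ (w refl)) (proj₂ (w refl))

count-≥2 : ∀ {m} (f : Fin m → Bool) i j → i ≢ j → f i ≡ true → f j ≡ true → 2 ≤ count f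
count-≥2 {suc m} f i j i≢j fi fj rewrite count-split f i | fi =
  s≤s (count-pos (f ∘ punchIn i) (punchOut i≢j) (trans (cong f (punchIn-punchOut i≢j)) fj))

count-≥3 : ∀ {m} (f : Fin m → Bool) i j k → i ≢ j → i ≢ k → j ≢ k →
  f i ≡ true → f j ≡ true → f k ≡ true → 3 ≤ count f
count-≥3 {suc m} f i j k i≢j i≢k j≢k fi fj fk rewrite count-split f i | fi =
  s≤s (count-≥2 (f ∘ punchIn i) (punchOut i≢j) (punchOut i≢k)
         (λ eq → j≢k (punchOut-injective i≢j i≢k eq))
         (trans (cong f (punchIn-punchOut i≢j)) fj) (trans (cong f (punchIn-punchOut i≢k)) fk))

count-none : ∀ {m} (f : Fin m → Bool) → (∀ i → f i ≡ false) → count f ≡ 0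
count-none {zero}  f h = refl
count-none {suc m} f h rewrite h zero = count-none (f ∘ suc) (h ∘ suc)

≟-punchIn : ∀ {m} (i : Fin (suc m)) j → isYes (punchIn i j ≟ i) ≡ false
≟-punchIn i j = isYes-false (punchIn i j ≟ i) (punchInᵢ≢i i j)

count-single : ∀ {m} (c : Bool) (i : Fin m) → count (λ j → c ∧ isYes (j ≟ i)) ≤ bit c
count-single {suc m} c i rewrite count-split (λ j → c ∧ isYes (j ≟ i)) i
  | count-none (λ j → c ∧ isYes (punchIn i j ≟ i)) (λ j → trans (cong (c ∧_) (≟-punchIn i j)) (∧-zeroʳ c)) =
  ≤-trans (≤-reflexive (+-comm _ 0)) (bit-mono (λ h → proj₁ (∧-true c _ h)))

count-insert : ∀ {m} (f : Fin m → Bool) i → count (λ j → f j ∨ isYes (j ≟ i)) ≤ suc (count f)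
count-insert {suc m} f i rewrite count-split (λ j → f j ∨ isYes (j ≟ i)) i | count-split f i
  | isYes-true (i ≟ i) refl | ∨-zeroʳ (f i) =
  s≤s (≤-trans (≤-reflexive (count-cong λ j → trans (cong (f (punchIn i j) ∨_) (≟-punchIn i j)) (∨-identityʳ _)))
               (m≤n+m _ _))

-- Walks and reachability in a subgraph (W, A) of a multigraph.

module _ {N : ℕ} (G : Graph N) where

  Joins-sym : ∀ {e x y} → Joins G e x y → Joins G e y x
  Joins-sym (inj₁ p) = inj₂ p
  Joins-sym (inj₂ p) = inj₁ p

  Joins-ends : ∀ {Q : Fin N → Set} {e x y} → Joins G e x y → Q x → Q y →
    Q (proj₁ (ends G e)) × Q (proj₂ (ends G e))
  Joins-ends {Q} (inj₁ eq) qx qy = subst (Q ∘ proj₁) (sym eq) qx , subst (Q ∘ proj₂) (sym eq) qy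
  Joins-ends {Q} (inj₂ eq) qx qy = subst (Q ∘ proj₁) (sym eq) qy , subst (Q ∘ proj₂) (sym eq) qx

  Reach-trans : ∀ {W A x y z} → Reach G W A x y → Reach G W A y z → Reach G W A x z
  Reach-trans here q = q
  Reach-trans (step e a wx wy j p) q = step e a wx wy j (Reach-trans p q)

  Reach-snoc : ∀ {W A x y z} → Reach G W A x y → ∀ e → A e → W y → W z → Joins G e y z → Reach G W A x z
  Reach-snoc p e a wy wz j = Reach-trans p (step e a wy wz j here)

  Reach-sym : ∀ {W A x y} → Reach G W A x y → Reach G W A y x
  Reach-sym here = here
  Reach-sym (step e a wx wy j p) = Reach-snoc (Reach-sym p) e a wy wx (Joins-sym j)

  Reach-mono : ∀ {W W' : Fin N → Set} {A A' : Edge G → Set} → (∀ {v} → W v → W' v) → (∀ {e} → A e → A' e) →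
    ∀ {x y} → Reach G W A x y → Reach G W' A' x y
  Reach-mono f g here = here
  Reach-mono f g (step e a wx wy j p) = step e (g a) (f wx) (f wy) j (Reach-mono f g p)

  Cycle-mono : ∀ {W W' : Fin N → Set} {A A' : Edge G → Set} → (∀ {v} → W v → W' v) → (∀ {e} → A e → A' e) →
    Cycle G W A → Cycle G W' A'
  Cycle-mono f g c = record
    { len = len ; vs = vs ; es = es ; vs-inj = vs-inj ; es-inj = es-inj
    ; vs-in = f ∘ vs-in ; es-in = g ∘ es-in ; joins = joins }
    where open Cycle c

Any-or-none : ∀ {A : Set} {Q : A → Set} → (∀ x → Dec (Q x)) → ∀ xs → Any Q xs ⊎ All (¬_ ∘ Q) xs
Any-or-none d [] = inj₂ []
Any-or-none d (x ∷ xs) with d x | Any-or-none d xs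
... | yes q  | _       = inj₁ (here q)
... | no _   | inj₁ a  = inj₁ (there a)
... | no ¬q  | inj₂ al = inj₂ (¬q ∷ al)

uniq-tail : ∀ {A : Set} {x : A} {xs} → Unique (x ∷ xs) → Unique xs
uniq-tail (_ ∷ u) = u

All-lookup : ∀ {A : Set} {Q : A → Set} (xs : List A) → All Q xs → ∀ i → Q (List.lookup xs i)
All-lookup (x ∷ xs) (q ∷ _)  zero    = q
All-lookup (x ∷ xs) (_ ∷ qs) (suc i) = All-lookup xs qs i

lookup-injective : ∀ {A B : Set} (g : A → B) (xs : List A) → Unique (map g xs) →
  ∀ {i j} → g (List.lookup xs i) ≡ g (List.lookup xs j) → i ≡ j
lookup-injective g (x ∷ xs) u       {zero}  {zero}  eq = refl
lookup-injective g (x ∷ xs) (a ∷ u) {zero}  {suc j} eq = ⊥-elim (All-lookup xs (AllP.map⁻ a) j eq)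
lookup-injective g (x ∷ xs) (a ∷ u) {suc i} {zero}  eq = ⊥-elim (All-lookup xs (AllP.map⁻ a) i (sym eq))
lookup-injective g (x ∷ xs) (a ∷ u) {suc i} {suc j} eq = cong suc (lookup-injective g xs u eq)

-- Reachability in G[W] is decidable when W is: a walk can be shortened to
-- one without repeated vertices, hence of length at most N, and walks of
-- bounded length are decided by exhaustive search.

module Decide-Reach {N : ℕ} (G : Graph N) (W : Fin N → Set) (W? : ∀ v → Dec (W v)) where

  ReachIn : Fin N → Fin N → Set
  ReachIn = Reach G W (AllEdges G)

  ReachWithin : ℕ → Fin N → Fin N → Set
  ReachWithin zero    x z = x ≡ z
  ReachWithin (suc k) x z =
    x ≡ z ⊎ Σ (Edge G) λ e → Σ (Fin N) λ y → W x × W y × Joins G e x y × ReachWithin k y z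

  Joins? : ∀ e x y → Dec (Joins G e x y)
  Joins? e x y = ≡-dec _≟_ _≟_ (ends G e) (x , y) ⊎-dec ≡-dec _≟_ _≟_ (ends G e) (y , x)

  ReachWithin? : ∀ k x z → Dec (ReachWithin k x z)
  ReachWithin? zero    x z = x ≟ z
  ReachWithin? (suc k) x z = (x ≟ z) ⊎-dec
    map′ (λ { (e , y , p) → e , y , p }) (λ { (e , y , p) → e , y , p })
      (any? λ e → any? λ y → W? x ×-dec W? y ×-dec Joins? e x y ×-dec ReachWithin? k y z)

  within⇒reach : ∀ k {x z} → ReachWithin k x z → ReachIn x z
  within⇒reach zero    refl = here
  within⇒reach (suc k) (inj₁ refl) = here
  within⇒reach (suc k) (inj₂ (e , y , wx , wy , j , p)) = step e tt wx wy j (within⇒reach k p)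

  within-mono : ∀ {k k'} → k ≤ k' → ∀ {x z} → ReachWithin k x z → ReachWithin k' x z
  within-mono {zero}  {zero}   le p = p
  within-mono {zero}  {suc k'} le p = inj₁ p
  within-mono {suc k} {suc k'} (s≤s le) (inj₁ p) = inj₁ p
  within-mono {suc k} {suc k'} (s≤s le) (inj₂ (e , y , wx , wy , j , p)) =
    inj₂ (e , y , wx , wy , j , within-mono le p)

  data Path : Fin N → Fin N → List (Fin N) → Set where
    stop : ∀ {v} → Path v v (v ∷ [])
    move : ∀ {x y z vs} e → W x → W y → Joins G e x y → Path y z vs → Path x z (x ∷ vs)

  path⇒within : ∀ {x z vs} → Path x z vs → ReachWithin (length vs) x z
  path⇒within stop = inj₁ refl
  path⇒within (move e wx wy j p) = inj₂ (e , _ , wx , wy , j , path⇒within p)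

  suffix : ∀ {x y z vs} → Path y z vs → Any (x ≡_) vs → Unique vs →
    Σ (List (Fin N)) λ vs' → Path x z vs' × Unique vs'
  suffix stop               (here refl) u = _ , stop , u
  suffix (move e wx wy j p) (here refl) u = _ , move e wx wy j p , u
  suffix stop (there ())
  suffix (move e wx wy j p) (there a) u = suffix p a (uniq-tail u)

  simple-path : ∀ {x z} → ReachIn x z → Σ (List (Fin N)) λ vs → Path x z vs × Unique vs
  simple-path here = _ ∷ [] , stop , [] ∷ []
  simple-path {x} (step e _ wx wy j p) with simple-path p
  ... | vs , q , uq with Any-or-none (x ≟_) vs
  ...   | inj₁ x∈vs = suffix q x∈vs uq
  ...   | inj₂ x∉vs = x ∷ vs , move e wx wy j q , x∉vs ∷ uq

  unique-length : ∀ (vs : List (Fin N)) → Unique vs → length vs ≤ N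
  unique-length vs u = injective⇒≤ (lookup-injective id vs (subst Unique (sym (map-id vs)) u))

  reach⇒within : ∀ {x z} → ReachIn x z → ReachWithin N x z
  reach⇒within r with simple-path r
  ... | vs , q , uq = within-mono (unique-length vs uq) (path⇒within q)

  Reach? : ∀ x z → Dec (ReachIn x z)
  Reach? x z = map′ (within⇒reach N) reach⇒within (ReachWithin? N x z)

PseudoforestAt : ∀ {N} (G : Graph N) (r : ℕ) (W : Fin N → Set) → Fin N → Set
PseudoforestAt G r W v = Σ (Subset (length G)) λ F →
    ∣ F ∣ ≤ r ×
    (∀ e → e ∈ F → InComp G W v (proj₁ (ends G e)) × InComp G W v (proj₂ (ends G e))) ×
    ¬ Cycle G (InComp G W v) (λ e → e ∉ F)

PseudoforestAt-reach : ∀ {N} (G : Graph N) r W {v v'} →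
  PseudoforestAt G r W v' → Reach G W (AllEdges G) v v' → PseudoforestAt G r W v
PseudoforestAt-reach G r W {v} (F , F≤r , F-ends , acyclic) v→v' =
  F , F≤r ,
  (λ e e∈F → let (x , y) = F-ends e e∈F in extend x , extend y) ,
  (λ c → acyclic (Cycle-mono G (λ { (w , p) → w , Reach-trans G (Reach-sym G v→v') p }) id c))
  where
  extend : ∀ {x} → InComp G W _ x → InComp G W v x
  extend (wx , p) = wx , Reach-trans G v→v' p

-- Induced subgraphs of r-pseudoforests are r-pseudoforests: keep the edges
-- of F inside the smaller component (this is where decidability is needed).
IsRPseudoforest-mono : ∀ {N} (G : Graph N) r (W W' : Fin N → Set) → (∀ {v} → W' v → W v) →
  (∀ v → Dec (W' v)) → IsRPseudoforest G r W → IsRPseudoforest G r W'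
IsRPseudoforest-mono {N} G r W W' W'⊆W W'? pf v w'v = F' , F'≤r , F'-ends , acyclic'
  where
  open Decide-Reach G W' W'?
  F : Subset (length G)
  F = proj₁ (pf v (W'⊆W w'v))
  F≤r : ∣ F ∣ ≤ r
  F≤r = proj₁ (proj₂ (pf v (W'⊆W w'v)))
  acyclic : ¬ Cycle G (InComp G W v) (λ e → e ∉ F)
  acyclic = proj₂ (proj₂ (proj₂ (pf v (W'⊆W w'v))))
  Comp' : Fin N → Set
  Comp' = InComp G W' v
  Comp'? : ∀ x → Dec (Comp' x)
  Comp'? x = W'? x ×-dec Reach? v x
  keep : Edge G → Bool
  keep e = lookup F e ∧ (isYes (Comp'? (proj₁ (ends G e))) ∧ isYes (Comp'? (proj₂ (ends G e))))
  F' : Subset (length G)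
  F' = tabulate keep
  F'≤r : ∣ F' ∣ ≤ r
  F'≤r = begin
    ∣ F' ∣           ≡⟨ ∣tabulate∣≡count keep ⟩
    count keep       ≤⟨ count-mono (λ e t → proj₁ (∧-true (lookup F e) _ t)) ⟩
    count (lookup F) ≡⟨ sym (∣∣≡count F) ⟩
    ∣ F ∣            ≤⟨ F≤r ⟩
    r                ∎
    where open ≤-Reasoning
  F'-ends : ∀ e → e ∈ F' → Comp' (proj₁ (ends G e)) × Comp' (proj₂ (ends G e))
  F'-ends e e∈F' =
    let t = proj₂ (∧-true (lookup F e) _ (trans (sym (lookup∘tabulate keep e)) (∈⇒true e∈F')))
        (t₁ , t₂) = ∧-true _ _ t
    in isYes-sound (Comp'? _) t₁ , isYes-sound (Comp'? _) t₂
  acyclic' : ¬ Cycle G Comp' (λ e → e ∉ F')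
  acyclic' c = acyclic (record
    { len = len ; vs = vs ; es = es ; vs-inj = vs-inj ; es-inj = es-inj
    ; vs-in = λ i → W'⊆W (proj₁ (vs-in i)) , Reach-mono G W'⊆W id (proj₂ (vs-in i))
    ; es-in = avoids-F ; joins = joins })
    where
    open Cycle c
    avoids-F : ∀ i → es i ∉ F
    avoids-F i e∈F with Joins-ends G {Comp'} (joins i) (vs-in i) (vs-in (csuc i))
    ... | c₁ , c₂ = es-in i (true⇒∈ (trans (lookup∘tabulate keep (es i))
      (cong₂ _∧_ (∈⇒true e∈F) (cong₂ _∧_ (isYes-true (Comp'? _) c₁) (isYes-true (Comp'? _) c₂)))))

-- Cycles as cyclic lists of steps (vᵢ , eᵢ), eᵢ joining vᵢ to vᵢ₊₁ and the
-- last edge returning to v₀.  Unlike Cycle, a list can be rotated to bring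
-- a chosen step to the front, and it is easy to splice steps in and out.

module _ {N : ℕ} (G : Graph N) where

  Step : Set
  Step = Fin N × Edge G

  Links : Step → List Step → Fin N → Set
  Links (v , e) []              h = Joins G e v h
  Links (v , e) ((w , f) ∷ qs)  h = Joins G e v w × Links (w , f) qs h

  IsCyclicList : (Step → Set) → List Step → Set
  IsCyclicList P []       = ⊥
  IsCyclicList P (p ∷ qs) =
    Links p qs (proj₁ p) × Unique (map proj₁ (p ∷ qs)) × Unique (map proj₂ (p ∷ qs)) × All P (p ∷ qs)

  CyclicList : (Step → Set) → Set
  CyclicList P = Σ (List Step) (IsCyclicList P)

  Inside : (Fin N → Set) → (Edge G → Set) → Step → Set
  Inside W A (v , e) = W v × A e

  Links-snoc : ∀ q qs h e h' → Links q qs h → Joins G e h h' → Links q (qs ++ [ (h , e) ]) h'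
  Links-snoc (v , f) []             h e h' l       j = l , j
  Links-snoc (v , f) ((w , g) ∷ qs) h e h' (j₁ , l) j = j₁ , Links-snoc (w , g) qs h e h' l j

  IsCyclicList-map : ∀ {P Q : Step → Set} → (∀ {p} → P p → Q p) → ∀ ps → IsCyclicList P ps → IsCyclicList Q ps
  IsCyclicList-map f (p ∷ qs) (l , uv , ue , al) = l , uv , ue , All.map f al

Unique-rotate : ∀ {A : Set} {y : A} {ys} → Unique (y ∷ ys) → Unique (ys ++ [ y ])
Unique-rotate {ys = []}     u = [] ∷ []
Unique-rotate {ys = z ∷ zs} ((y≢z ∷ y∉zs) ∷ (z∉zs ∷ uzs)) =
  AllP.++⁺ z∉zs ((λ eq → y≢z (sym eq)) ∷ []) ∷ Unique-rotate (y∉zs ∷ uzs)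

module _ {N : ℕ} (G : Graph N) where

  rotate-one : ∀ {P} p q qs → IsCyclicList G P (p ∷ q ∷ qs) → IsCyclicList G P (q ∷ qs ++ [ p ])
  rotate-one (v , e) q qs ((j , l) , uv , ue , p∈P ∷ qs∈P) =
    Links-snoc G q qs v e (proj₁ q) l j ,
    subst Unique (sym (map-++ proj₁ (q ∷ qs) _)) (Unique-rotate uv) ,
    subst Unique (sym (map-++ proj₂ (q ∷ qs) _)) (Unique-rotate ue) ,
    AllP.++⁺ qs∈P (p∈P ∷ [])

  rotate : ∀ {P} xs y ys → IsCyclicList G P (xs ++ y ∷ ys) → IsCyclicList G P (y ∷ ys ++ xs)
  rotate {P} []       y ys c = subst (IsCyclicList G P) (sym (cong (y ∷_) (++-identityʳ ys))) c
  rotate {P} (x ∷ []) y ys c = rotate-one x y ys c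
  rotate {P} (x ∷ x' ∷ xs) y ys c =
    let c₁ = rotate-one x x' (xs ++ y ∷ ys) c
        c₂ = subst (λ l → IsCyclicList G P (x' ∷ l)) (++-assoc xs (y ∷ ys) [ x ]) c₁
        c₃ = rotate (x' ∷ xs) y (ys ++ [ x ]) c₂
    in subst (λ l → IsCyclicList G P (y ∷ l)) (++-assoc ys [ x ] (x' ∷ xs)) c₃

  split-at-Any : ∀ {Q : Step G → Set} ps → Any Q ps →
    Σ (List (Step G)) λ xs → Σ (Step G) λ y → Σ (List (Step G)) λ ys → ps ≡ xs ++ y ∷ ys × Q y
  split-at-Any (p ∷ ps) (here q) = [] , p , ps , refl , q
  split-at-Any (p ∷ ps) (there a) with split-at-Any ps a
  ... | xs , y , ys , eq , q = p ∷ xs , y , ys , cong (p ∷_) eq , q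

  bring-to-front : ∀ {P} {Q : Step G → Set} ps → IsCyclicList G P ps → Any Q ps →
    Σ (Step G) λ y → Σ (List (Step G)) λ ys → IsCyclicList G P (y ∷ ys) × Q y
  bring-to-front {P} ps c a with split-at-Any ps a
  ... | xs , y , ys , eq , q = y , ys ++ xs , rotate xs y ys (subst (IsCyclicList G P) eq c) , q

csuc-inject₁ : ∀ {k} (i : Fin k) → csuc (inject₁ i) ≡ suc i
csuc-inject₁ {k} i with suc (toℕ (inject₁ i)) <? suc k
... | yes p = toℕ-injective (trans (toℕ-fromℕ< p) (cong suc (toℕ-inject₁ i)))
... | no ¬p = ⊥-elim (¬p (s≤s (subst (_< k) (sym (toℕ-inject₁ i)) (toℕ<n i))))

csuc-last : ∀ k → csuc (fromℕ k) ≡ zero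
csuc-last k with suc (toℕ (fromℕ k)) <? suc k
... | yes p = ⊥-elim (<-irrefl refl (subst (λ z → suc z < suc k) (toℕ-fromℕ k) p))
... | no ¬p = refl

last-or-inject₁ : ∀ {k} (i : Fin (suc k)) → i ≡ fromℕ k ⊎ Σ (Fin k) λ j → i ≡ inject₁ j
last-or-inject₁ {zero}  zero    = inj₁ refl
last-or-inject₁ {suc k} zero    = inj₂ (zero , refl)
last-or-inject₁ {suc k} (suc i) with last-or-inject₁ i
... | inj₁ eq       = inj₁ (cong suc eq)
... | inj₂ (j , eq) = inj₂ (suc j , cong suc eq)

module _ {N : ℕ} (G : Graph N) where

  tabulate-Links : ∀ m (v : Fin (suc m) → Fin N) (e : Fin (suc m) → Edge G) h →
    (∀ (i : Fin m) → Joins G (e (inject₁ i)) (v (inject₁ i)) (v (suc i))) →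
    Joins G (e (fromℕ m)) (v (fromℕ m)) h →
    Links G (v zero , e zero) (List.tabulate (λ i → v (suc i) , e (suc i))) h
  tabulate-Links zero    v e h js jl = jl
  tabulate-Links (suc m) v e h js jl =
    js zero , tabulate-Links m (v ∘ suc) (e ∘ suc) h (js ∘ suc) jl

  lookup-Links : ∀ p qs h → Links G p qs h →
    (∀ (i : Fin (length qs)) →
       Joins G (proj₂ (List.lookup (p ∷ qs) (inject₁ i))) (proj₁ (List.lookup (p ∷ qs) (inject₁ i)))
               (proj₁ (List.lookup (p ∷ qs) (suc i)))) ×
    Joins G (proj₂ (List.lookup (p ∷ qs) (fromℕ (length qs)))) (proj₁ (List.lookup (p ∷ qs) (fromℕ (length qs)))) h
  lookup-Links (v , e) []             h l       = (λ ()) , l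
  lookup-Links (v , e) ((w , f) ∷ qs) h (j , l) with lookup-Links (w , f) qs h l
  ... | js , jl = (λ { zero → j ; (suc i) → js i }) , jl

  cycle⇒list : ∀ {W A} → Cycle G W A → CyclicList G (Inside G W A)
  cycle⇒list c = List.tabulate stepAt ,
    tabulate-Links len vs es (vs zero)
      (λ i → subst (Joins G (es (inject₁ i)) (vs (inject₁ i)) ∘ vs) (csuc-inject₁ i) (joins (inject₁ i)))
      (subst (Joins G (es (fromℕ len)) (vs (fromℕ len)) ∘ vs) (csuc-last len) (joins (fromℕ len))) ,
    subst Unique (sym (map-tabulate stepAt proj₁)) (UniqueP.tabulate⁺ vs-inj) ,
    subst Unique (sym (map-tabulate stepAt proj₂)) (UniqueP.tabulate⁺ es-inj) ,
    AllP.tabulate⁺ (λ i → vs-in i , es-in i)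
    where
    open Cycle c
    stepAt : Fin (suc len) → Step G
    stepAt i = vs i , es i

  list⇒cycle : ∀ {W A} → CyclicList G (Inside G W A) → Cycle G W A
  list⇒cycle (p ∷ qs , l , uv , ue , al) = record
    { len = length qs ; vs = vs ; es = es
    ; vs-inj = lookup-injective proj₁ (p ∷ qs) uv
    ; es-inj = lookup-injective proj₂ (p ∷ qs) ue
    ; vs-in = proj₁ ∘ All-lookup (p ∷ qs) al
    ; es-in = proj₂ ∘ All-lookup (p ∷ qs) al
    ; joins = joins }
    where
    vs : Fin (suc (length qs)) → Fin N
    vs i = proj₁ (List.lookup (p ∷ qs) i)
    es : Fin (suc (length qs)) → Edge G
    es i = proj₂ (List.lookup (p ∷ qs) i)
    joins : ∀ i → Joins G (es i) (vs i) (vs (csuc i))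
    joins i with last-or-inject₁ i
    ... | inj₁ refl = subst (Joins G (es (fromℕ (length qs))) (vs (fromℕ (length qs))) ∘ vs)
                            (sym (csuc-last (length qs))) (proj₂ (lookup-Links p qs (proj₁ p) l))
    ... | inj₂ (j , refl) = subst (Joins G (es (inject₁ j)) (vs (inject₁ j)) ∘ vs)
                                  (sym (csuc-inject₁ j)) (proj₁ (lookup-Links p qs (proj₁ p) l) j)

module Embedding {N₁ N₂ : ℕ} (G₁ : Graph N₁) (G₂ : Graph N₂)
  (φ : Fin N₁ → Fin N₂) (ψ : Edge G₁ → Edge G₂)
  (ends-ψ : ∀ e → ends G₂ (ψ e) ≡ (φ (proj₁ (ends G₁ e)) , φ (proj₂ (ends G₁ e))))
  (φ-inj : ∀ {x y} → φ x ≡ φ y → x ≡ y) (ψ-inj : ∀ {d d'} → ψ d ≡ ψ d' → d ≡ d') where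

  image : Step G₁ → Step G₂
  image p = φ (proj₁ p) , ψ (proj₂ p)

  Joins→ : ∀ {e x y} → Joins G₁ e x y → Joins G₂ (ψ e) (φ x) (φ y)
  Joins→ {e} (inj₁ eq) = inj₁ (trans (ends-ψ e) (cong (λ q → φ (proj₁ q) , φ (proj₂ q)) eq))
  Joins→ {e} (inj₂ eq) = inj₂ (trans (ends-ψ e) (cong (λ q → φ (proj₁ q) , φ (proj₂ q)) eq))

  Joins← : ∀ {e x y} → Joins G₂ (ψ e) (φ x) (φ y) → Joins G₁ e x y
  Joins← {e} (inj₁ eq) with ,-injective (trans (sym (ends-ψ e)) eq)
  ... | p , q = inj₁ (cong₂ _,_ (φ-inj p) (φ-inj q))
  Joins← {e} (inj₂ eq) with ,-injective (trans (sym (ends-ψ e)) eq)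
  ... | p , q = inj₂ (cong₂ _,_ (φ-inj p) (φ-inj q))

  Links→ : ∀ p qs h → Links G₁ p qs h → Links G₂ (image p) (map image qs) (φ h)
  Links→ (v , e) []             h l       = Joins→ l
  Links→ (v , e) ((w , f) ∷ qs) h (j , l) = Joins→ j , Links→ (w , f) qs h l

  Links← : ∀ p qs h → Links G₂ (image p) (map image qs) (φ h) → Links G₁ p qs h
  Links← (v , e) []             h l       = Joins← l
  Links← (v , e) ((w , f) ∷ qs) h (j , l) = Joins← j , Links← (w , f) qs h l

  vertices-image : ∀ ps → map proj₁ (map image ps) ≡ map φ (map proj₁ ps)
  vertices-image ps = trans (sym (map-∘ ps)) (map-∘ ps)

  edges-image : ∀ ps → map proj₂ (map image ps) ≡ map ψ (map proj₂ ps)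
  edges-image ps = trans (sym (map-∘ ps)) (map-∘ ps)

  Unique-vertices→ : ∀ ps → Unique (map proj₁ ps) → Unique (map proj₁ (map image ps))
  Unique-vertices→ ps u = subst Unique (sym (vertices-image ps)) (UniqueP.map⁺ φ-inj u)

  Unique-edges→ : ∀ ps → Unique (map proj₂ ps) → Unique (map proj₂ (map image ps))
  Unique-edges→ ps u = subst Unique (sym (edges-image ps)) (UniqueP.map⁺ ψ-inj u)

  Unique-vertices← : ∀ ps → Unique (map proj₁ (map image ps)) → Unique (map proj₁ ps)
  Unique-vertices← ps u = UniqueP.map⁻ (subst Unique (vertices-image ps) u)

  Unique-edges← : ∀ ps → Unique (map proj₂ (map image ps)) → Unique (map proj₂ ps)
  Unique-edges← ps u = UniqueP.map⁻ (subst Unique (edges-image ps) u)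

  cyclic→ : ∀ {P : Step G₂ → Set} ps → IsCyclicList G₁ (P ∘ image) ps → IsCyclicList G₂ P (map image ps)
  cyclic→ (p ∷ qs) (l , uv , ue , al) =
    Links→ p qs (proj₁ p) l , Unique-vertices→ (p ∷ qs) uv , Unique-edges→ (p ∷ qs) ue , AllP.map⁺ al

  cyclic← : ∀ {P : Step G₂ → Set} ps → IsCyclicList G₂ P (map image ps) → IsCyclicList G₁ (P ∘ image) ps
  cyclic← (p ∷ qs) (l , uv , ue , al) =
    Links← p qs (proj₁ p) l , Unique-vertices← (p ∷ qs) uv , Unique-edges← (p ∷ qs) ue , AllP.map⁻ al

preimage : ∀ {A B : Set} (f : A → B) (xs : List B) → All (λ x → Σ A λ y → f y ≡ x) xs →
  Σ (List A) λ ys → map f ys ≡ xs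
preimage f [] [] = [] , refl
preimage f (x ∷ xs) ((y , eq) ∷ as) with preimage f xs as
... | ys , eqs = y ∷ ys , cong₂ _∷_ eq eqs

All-≢-map : ∀ {A B : Set} (f : A → B) {x : B} xs → (∀ y → x ≢ f y) → All (x ≢_) (map f xs)
All-≢-map f []       h = []
All-≢-map f (y ∷ ys) h = h y ∷ All-≢-map f ys h

module Append {A : Set} where

  old : ∀ (L : List A) z → Fin (length L) → Fin (length (L ++ [ z ]))
  old (x ∷ L) z zero    = zero
  old (x ∷ L) z (suc i) = suc (old L z i)

  new : ∀ (L : List A) z → Fin (length (L ++ [ z ]))
  new []      z = zero
  new (x ∷ L) z = suc (new L z)

  lookup-old : ∀ L z i → List.lookup (L ++ [ z ]) (old L z i) ≡ List.lookup L i
  lookup-old (x ∷ L) z zero    = refl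
  lookup-old (x ∷ L) z (suc i) = lookup-old L z i

  lookup-new : ∀ L z → List.lookup (L ++ [ z ]) (new L z) ≡ z
  lookup-new []      z = refl
  lookup-new (x ∷ L) z = lookup-new L z

  old-or-new : ∀ L z (i : Fin (length (L ++ [ z ]))) → (Σ (Fin (length L)) λ j → old L z j ≡ i) ⊎ i ≡ new L z
  old-or-new []      z zero    = inj₂ refl
  old-or-new (x ∷ L) z zero    = inj₁ (zero , refl)
  old-or-new (x ∷ L) z (suc i) with old-or-new L z i
  ... | inj₁ (j , eq) = inj₁ (suc j , cong suc eq)
  ... | inj₂ eq       = inj₂ (cong suc eq)

  old-injective : ∀ L z {i j} → old L z i ≡ old L z j → i ≡ j
  old-injective (x ∷ L) z {zero}  {zero}  eq = refl
  old-injective (x ∷ L) z {suc i} {suc j} eq = cong suc (old-injective L z (suc-injective eq))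

  old≢new : ∀ L z i → old L z i ≢ new L z
  old≢new (x ∷ L) z zero    ()
  old≢new (x ∷ L) z (suc i) eq = old≢new L z i (suc-injective eq)

  count-append : ∀ L z (f : Fin (length (L ++ [ z ])) → Bool) →
    count f ≡ count (f ∘ old L z) + bit (f (new L z))
  count-append []      z f = +-comm (bit (f zero)) 0
  count-append (x ∷ L) z f = trans (cong (bit (f zero) +_) (count-append L z (f ∘ suc)))
                                   (sym (+-assoc (bit (f zero)) _ _))

module Delete {n : ℕ} (u : Fin (suc n)) where

  ι : Fin n → Fin (suc n)
  ι = punchIn u

  ι-injective : ∀ {x y} → ι x ≡ ι y → x ≡ y
  ι-injective {x} {y} = punchIn-injective u x y

  ι≢u : ∀ x → ι x ≢ u
  ι≢u x = punchInᵢ≢i u x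

  u-or-ι : ∀ (v : Fin (suc n)) → v ≡ u ⊎ Σ (Fin n) λ x → ι x ≡ v
  u-or-ι v with u ≟ v
  ... | yes p = inj₁ (sym p)
  ... | no  p = inj₂ (punchOut p , punchIn-punchOut p)

  Incident : ∀ (G : Graph (suc n)) → Edge G → Set
  Incident G e = proj₁ (ends G e) ≡ u ⊎ proj₂ (ends G e) ≡ u

  emb : ∀ (G : Graph (suc n)) → Edge (deleteVertex u G) → Edge G
  emb ((x , y) ∷ es) d with u ≟ x | u ≟ y
  emb ((x , y) ∷ es) zero    | no p  | no q = zero
  emb ((x , y) ∷ es) (suc d) | no p  | no q = suc (emb es d)
  emb ((x , y) ∷ es) d       | yes p | _    = suc (emb es d)
  emb ((x , y) ∷ es) d       | no p  | yes q = suc (emb es d)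

  ends-emb : ∀ G d → ends G (emb G d) ≡ (ι (proj₁ (ends (deleteVertex u G) d)) , ι (proj₂ (ends (deleteVertex u G) d)))
  ends-emb ((x , y) ∷ es) d with u ≟ x | u ≟ y
  ends-emb ((x , y) ∷ es) zero    | no p  | no q  = sym (cong₂ _,_ (punchIn-punchOut p) (punchIn-punchOut q))
  ends-emb ((x , y) ∷ es) (suc d) | no p  | no q  = ends-emb es d
  ends-emb ((x , y) ∷ es) d       | yes p | _     = ends-emb es d
  ends-emb ((x , y) ∷ es) d       | no p  | yes q = ends-emb es d

  emb-injective : ∀ G {d d'} → emb G d ≡ emb G d' → d ≡ d'
  emb-injective ((x , y) ∷ es) {d} {d'} eq with u ≟ x | u ≟ y
  emb-injective ((x , y) ∷ es) {zero}  {zero}   eq | no p  | no q  = refl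
  emb-injective ((x , y) ∷ es) {suc d} {suc d'} eq | no p  | no q  = cong suc (emb-injective es (suc-injective eq))
  emb-injective ((x , y) ∷ es) {d}     {d'}     eq | yes p | _     = emb-injective es (suc-injective eq)
  emb-injective ((x , y) ∷ es) {d}     {d'}     eq | no p  | yes q = emb-injective es (suc-injective eq)

  emb-or-incident : ∀ G (e : Edge G) → (Σ (Edge (deleteVertex u G)) λ d → emb G d ≡ e) ⊎ Incident G e
  emb-or-incident ((x , y) ∷ es) e with u ≟ x | u ≟ y
  emb-or-incident ((x , y) ∷ es) zero    | no p | no q = inj₁ (zero , refl)
  emb-or-incident ((x , y) ∷ es) (suc e) | no p | no q with emb-or-incident es e
  ... | inj₁ (d , eq) = inj₁ (suc d , cong suc eq)
  ... | inj₂ i        = inj₂ i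
  emb-or-incident ((x , y) ∷ es) zero    | yes p | _ = inj₂ (inj₁ (sym p))
  emb-or-incident ((x , y) ∷ es) (suc e) | yes p | _ with emb-or-incident es e
  ... | inj₁ (d , eq) = inj₁ (d , cong suc eq)
  ... | inj₂ i        = inj₂ i
  emb-or-incident ((x , y) ∷ es) zero    | no p | yes q = inj₂ (inj₂ (sym q))
  emb-or-incident ((x , y) ∷ es) (suc e) | no p | yes q with emb-or-incident es e
  ... | inj₁ (d , eq) = inj₁ (d , cong suc eq)
  ... | inj₂ i        = inj₂ i

  emb-not-incident : ∀ G d → ¬ Incident G (emb G d)
  emb-not-incident G d (inj₁ eq) = ι≢u _ (trans (sym (cong proj₁ (ends-emb G d))) eq)
  emb-not-incident G d (inj₂ eq) = ι≢u _ (trans (sym (cong proj₂ (ends-emb G d))) eq)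

  incident⇒true : ∀ G {e} → Incident G e → incident? G u e ≡ true
  incident⇒true G {e} (inj₁ eq) rewrite isYes-true (proj₁ (ends G e) ≟ u) eq = refl
  incident⇒true G {e} (inj₂ eq) rewrite isYes-true (proj₂ (ends G e) ≟ u) eq = ∨-zeroʳ _

  true⇒incident : ∀ G {e} → incident? G u e ≡ true → Incident G e
  true⇒incident G {e} h with ∨-true (isYes (proj₁ (ends G e) ≟ u)) _ h
  ... | inj₁ t = inj₁ (isYes-sound (proj₁ (ends G e) ≟ u) t)
  ... | inj₂ t = inj₂ (isYes-sound (proj₂ (ends G e) ≟ u) t)

  count-deleteVertex : ∀ G (f : Edge G → Bool) →
    count f ≡ count (f ∘ emb G) + count (λ e → f e ∧ incident? G u e)
  count-deleteVertex [] f = refl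
  count-deleteVertex ((x , y) ∷ es) f with u ≟ x | u ≟ y
  ... | no p | no q rewrite isYes-false (x ≟ u) (p ∘ sym) | isYes-false (y ≟ u) (q ∘ sym) | ∧-zeroʳ (f zero) =
      trans (cong (bit (f zero) +_) (count-deleteVertex es (f ∘ suc)))
            (sym (+-assoc (bit (f zero)) _ _))
  ... | yes p | _ rewrite isYes-true (x ≟ u) (sym p) | ∧-identityʳ (f zero) =
      trans (cong (bit (f zero) +_) (count-deleteVertex es (f ∘ suc)))
            (+-exchange (bit (f zero)) (count (f ∘ suc ∘ emb es)) (count (λ e → f (suc e) ∧ incident? es u e)))
  ... | no p | yes q rewrite isYes-false (x ≟ u) (p ∘ sym) | isYes-true (y ≟ u) (sym q) | ∧-identityʳ (f zero) =
      trans (cong (bit (f zero) +_) (count-deleteVertex es (f ∘ suc)))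
            (+-exchange (bit (f zero)) (count (f ∘ suc ∘ emb es)) (count (λ e → f (suc e) ∧ incident? es u e)))

module Vertex-Sets {n : ℕ} (u : Fin (suc n)) where

  open Delete u

  lookup-restrict : ∀ X w → lookup (restrict u X) w ≡ lookup X (ι w)
  lookup-restrict X w = lookup∘tabulate (lookup X ∘ punchIn u) w

  restrict-∈⁻ : ∀ {X w} → w ∈ restrict u X → ι w ∈ X
  restrict-∈⁻ {X} {w} w∈ = true⇒∈ (trans (sym (lookup-restrict X w)) (∈⇒true w∈))

  restrict-∈⁺ : ∀ {X w} → ι w ∈ X → w ∈ restrict u X
  restrict-∈⁺ {X} {w} ιw∈ = true⇒∈ (trans (lookup-restrict X w) (∈⇒true ιw∈))

  ∣restrict∣ : ∀ X → ∣ X ∣ ≡ bit (lookup X u) + ∣ restrict u X ∣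
  ∣restrict∣ X = trans (∣∣≡count X) (trans (count-split (lookup X) u)
                 (cong (bit (lookup X u) +_) (sym (trans (∣∣≡count (restrict u X)) (count-cong (lookup-restrict X))))))

  restrict-disjoint : ∀ {X S : Subset (suc n)} → (∀ v → v ∈ X → v ∉ S) → ∀ w → w ∈ restrict u X → w ∉ restrict u S
  restrict-disjoint X∩S=∅ w w∈X w∈S = X∩S=∅ (ι w) (restrict-∈⁻ w∈X) (restrict-∈⁻ w∈S)

  lift : Subset n → Subset (suc n)
  lift X' = insertAt X' u false

  u∉lift : ∀ X' → u ∉ lift X'
  u∉lift X' = false⇒∉ (insertAt-lookup X' u false)

  lookup-lift : ∀ X' w → lookup (lift X') (ι w) ≡ lookup X' w
  lookup-lift X' w = insertAt-punchIn X' u false w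

  lift-∈⁻ : ∀ {X' w} → ι w ∈ lift X' → w ∈ X'
  lift-∈⁻ {X'} {w} ιw∈ = true⇒∈ (trans (sym (lookup-lift X' w)) (∈⇒true ιw∈))

  lift-∈⁺ : ∀ {X' w} → w ∈ X' → ι w ∈ lift X'
  lift-∈⁺ {X'} {w} w∈ = true⇒∈ (trans (lookup-lift X' w) (∈⇒true w∈))

  ∣lift∣ : ∀ X' → ∣ lift X' ∣ ≡ ∣ X' ∣
  ∣lift∣ X' = trans (∣∣≡count (lift X')) (trans (count-split (lookup (lift X')) u)
              (trans (cong (λ x → bit x + count (lookup (lift X') ∘ ι)) (insertAt-lookup X' u false))
              (trans (count-cong (lookup-lift X')) (sym (∣∣≡count X')))))

add : ∀ {m} → Subset m → Fin m → Subset m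
add X c = tabulate (λ v → lookup X v ∨ isYes (v ≟ c))

module _ {m : ℕ} (X : Subset m) (c : Fin m) where

  lookup-add : ∀ v → lookup (add X c) v ≡ lookup X v ∨ isYes (v ≟ c)
  lookup-add = lookup∘tabulate (λ v → lookup X v ∨ isYes (v ≟ c))

  c∈add : c ∈ add X c
  c∈add = true⇒∈ (trans (lookup-add c) (trans (cong (lookup X c ∨_) (isYes-true (c ≟ c) refl)) (∨-zeroʳ _)))

  ⊆add : ∀ {v} → v ∈ X → v ∈ add X c
  ⊆add {v} v∈X = true⇒∈ (trans (lookup-add v) (cong (_∨ isYes (v ≟ c)) (∈⇒true v∈X)))

  ∈add⁻ : ∀ {v} → v ∈ add X c → v ∈ X ⊎ v ≡ c
  ∈add⁻ {v} v∈ with ∨-true (lookup X v) _ (trans (sym (lookup-add v)) (∈⇒true v∈))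
  ... | inj₁ t = inj₁ (true⇒∈ t)
  ... | inj₂ t = inj₂ (isYes-sound (v ≟ c) t)

  ∣add∣ : ∣ add X c ∣ ≤ suc ∣ X ∣
  ∣add∣ = begin
    ∣ add X c ∣                               ≡⟨ ∣tabulate∣≡count (λ v → lookup X v ∨ isYes (v ≟ c)) ⟩
    count (λ v → lookup X v ∨ isYes (v ≟ c)) ≤⟨ count-insert (lookup X) c ⟩
    suc (count (lookup X))                   ≡⟨ cong suc (sym (∣∣≡count X)) ⟩
    suc ∣ X ∣                                ∎
    where open ≤-Reasoning

-- The bypass construction.  Throughout, u has degree two with incident
-- edges e₁ (to a) and e₂ (to b), D = G - u and H = D + ν with ν joining
-- a' and b', the names of a and b in D.

module Bypass {n : ℕ} (G : Graph (suc n)) (u a b : Fin (suc n)) (e₁ e₂ : Edge G) (e₁≢e₂ : e₁ ≢ e₂)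
  (j₁ : Joins G e₁ u a) (j₂ : Joins G e₂ u b) (u≢a : u ≢ a) (u≢b : u ≢ b) (deg : degree G u ≡ 2) where

  open Delete u
  open Append

  D : Graph n
  D = deleteVertex u G

  a' b' : Fin n
  a' = punchOut u≢a
  b' = punchOut u≢b

  H : Graph n
  H = bypass G u a b u≢a u≢b

  embD : Edge D → Edge H
  embD = old D (a' , b')

  ν : Edge H
  ν = new D (a' , b')

  ιa : ι a' ≡ a
  ιa = punchIn-punchOut u≢a

  ιb : ι b' ≡ b
  ιb = punchIn-punchOut u≢b

  ends-embD : ∀ d → ends H (embD d) ≡ ends D d
  ends-embD = lookup-old D (a' , b')

  ends-ν : ends H ν ≡ (a' , b')
  ends-ν = lookup-new D (a' , b')

  module EG = Embedding D G ι (emb G) (ends-emb G) ι-injective (emb-injective G)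
  module EH = Embedding D H id embD ends-embD id (old-injective D (a' , b'))

  Joins-u⇒incident : ∀ {e x} → Joins G e u x → Incident G e
  Joins-u⇒incident (inj₁ eq) = inj₁ (cong proj₁ eq)
  Joins-u⇒incident (inj₂ eq) = inj₂ (cong proj₂ eq)

  incident-e₁ : Incident G e₁
  incident-e₁ = Joins-u⇒incident j₁

  incident-e₂ : Incident G e₂
  incident-e₂ = Joins-u⇒incident j₂

  -- u has degree two, so e₁ and e₂ are its only edges.
  incident-e₁e₂ : ∀ {e} → Incident G e → e ≡ e₁ ⊎ e ≡ e₂
  incident-e₁e₂ {e} i with e ≟ e₁ | e ≟ e₂
  ... | yes p | _     = inj₁ p
  ... | no _  | yes q = inj₂ q
  ... | no p  | no q  = ⊥-elim (<-irrefl refl (≤-trans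
        (count-≥3 (incident? G u) e₁ e₂ e e₁≢e₂ (p ∘ sym) (q ∘ sym)
           (incident⇒true G incident-e₁) (incident⇒true G incident-e₂) (incident⇒true G i))
        (≤-reflexive (trans (sym (∣tabulate∣≡count (incident? G u))) deg))))

  incident-pair : ∀ {g f e} → Incident G g → Incident G f → g ≢ f → Incident G e → e ≡ g ⊎ e ≡ f
  incident-pair ig if g≢f ie with incident-e₁e₂ ig | incident-e₁e₂ if | incident-e₁e₂ ie
  ... | inj₁ refl | inj₁ refl | _         = ⊥-elim (g≢f refl)
  ... | inj₂ refl | inj₂ refl | _         = ⊥-elim (g≢f refl)
  ... | inj₁ refl | inj₂ refl | inj₁ refl = inj₁ refl
  ... | inj₁ refl | inj₂ refl | inj₂ refl = inj₂ refl
  ... | inj₂ refl | inj₁ refl | inj₁ refl = inj₂ refl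
  ... | inj₂ refl | inj₁ refl | inj₂ refl = inj₁ refl

  Joins-from-u : ∀ {e c x y} → Joins G e u c → Joins G e x y → (x ≡ u × y ≡ c) ⊎ (x ≡ c × y ≡ u)
  Joins-from-u (inj₁ p) (inj₁ q) with ,-injective (trans (sym p) q)
  ... | r , s = inj₁ (sym r , sym s)
  Joins-from-u (inj₁ p) (inj₂ q) with ,-injective (trans (sym p) q)
  ... | r , s = inj₂ (sym s , sym r)
  Joins-from-u (inj₂ p) (inj₁ q) with ,-injective (trans (sym p) q)
  ... | r , s = inj₂ (sym r , sym s)
  Joins-from-u (inj₂ p) (inj₂ q) with ,-injective (trans (sym p) q)
  ... | r , s = inj₁ (sym s , sym r)

  edge-at-u : ∀ {e x y} → Joins G e x y → x ≡ u → (e ≡ e₁ × y ≡ a) ⊎ (e ≡ e₂ × y ≡ b)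
  edge-at-u j refl with incident-e₁e₂ (Joins-u⇒incident j)
  ... | inj₁ refl with Joins-from-u j₁ j
  ...   | inj₁ (_ , y≡a) = inj₁ (refl , y≡a)
  ...   | inj₂ (u≡a , _) = ⊥-elim (u≢a u≡a)
  edge-at-u j refl | inj₂ refl with Joins-from-u j₂ j
  ...   | inj₁ (_ , y≡b) = inj₂ (refl , y≡b)
  ...   | inj₂ (u≡b , _) = ⊥-elim (u≢b u≡b)

  not-incident : ∀ {e x y} → Joins G e x y → x ≢ u → y ≢ u → ¬ Incident G e
  not-incident (inj₁ eq) x≢u y≢u (inj₁ i) = x≢u (trans (sym (cong proj₁ eq)) i)
  not-incident (inj₁ eq) x≢u y≢u (inj₂ i) = y≢u (trans (sym (cong proj₂ eq)) i)
  not-incident (inj₂ eq) x≢u y≢u (inj₁ i) = y≢u (trans (sym (cong proj₁ eq)) i)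
  not-incident (inj₂ eq) x≢u y≢u (inj₂ i) = x≢u (trans (sym (cong proj₂ eq)) i)

  ν-ends : ∀ {x' y'} → Joins H ν x' y' → (x' ≡ a' × y' ≡ b') ⊎ (x' ≡ b' × y' ≡ a')
  ν-ends (inj₁ eq) with ,-injective (trans (sym ends-ν) eq)
  ... | r , s = inj₁ (sym r , sym s)
  ν-ends (inj₂ eq) with ,-injective (trans (sym ends-ν) eq)
  ... | r , s = inj₂ (sym s , sym r)

  ν-a'b' : Joins H ν a' b'
  ν-a'b' = inj₁ ends-ν

  ν-b'a' : Joins H ν b' a'
  ν-b'a' = inj₂ ends-ν

  shortcut : ∀ {g f y' z'} → Joins G g (ι y') u → Joins G f u (ι z') → g ≢ f → Joins H ν y' z'
  shortcut jg jf g≢f with edge-at-u (Joins-sym G jg) refl | edge-at-u jf refl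
  ... | inj₁ (refl , p) | inj₁ (refl , q) = ⊥-elim (g≢f refl)
  ... | inj₂ (refl , p) | inj₂ (refl , q) = ⊥-elim (g≢f refl)
  ... | inj₁ (refl , p) | inj₂ (refl , q) =
        subst₂ (Joins H ν) (ι-injective (trans ιa (sym p))) (ι-injective (trans ιb (sym q))) ν-a'b'
  ... | inj₂ (refl , p) | inj₁ (refl , q) =
        subst₂ (Joins H ν) (ι-injective (trans ιb (sym p))) (ι-injective (trans ιa (sym q))) ν-b'a'

  Both : Edge G → Edge G → Set
  Both eα eβ = (eα ≡ e₁ × eβ ≡ e₂) ⊎ (eα ≡ e₂ × eβ ≡ e₁)

  Both-facts : ∀ {eα eβ} → Both eα eβ → Incident G eα × Incident G eβ × eα ≢ eβ
  Both-facts (inj₁ (refl , refl)) = incident-e₁ , incident-e₂ , e₁≢e₂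
  Both-facts (inj₂ (refl , refl)) = incident-e₂ , incident-e₁ , e₁≢e₂ ∘ sym

  expand : ∀ x' → Σ (Edge G) λ eα → Σ (Edge G) λ eβ → Both eα eβ ×
    (∀ y' → Joins H ν x' y' → Joins G eα (ι x') u × Joins G eβ u (ι y'))
  expand x' with x' ≟ a'
  ... | yes refl = e₁ , e₂ , inj₁ (refl , refl) , via-a
    where
    via-a : ∀ y' → Joins H ν a' y' → Joins G e₁ (ι a') u × Joins G e₂ u (ι y')
    via-a y' j with ν-ends j
    ... | inj₁ (_ , refl)  = subst (λ z → Joins G e₁ z u) (sym ιa) (Joins-sym G j₁) , subst (Joins G e₂ u) (sym ιb) j₂
    ... | inj₂ (eq , refl) = subst (λ z → Joins G e₁ z u) (sym ιa) (Joins-sym G j₁) ,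
                             subst (Joins G e₂ u) (trans (sym ιb) (cong ι (sym eq))) j₂
  ... | no x'≢a' = e₂ , e₁ , inj₂ (refl , refl) , via-b
    where
    via-b : ∀ y' → Joins H ν x' y' → Joins G e₂ (ι x') u × Joins G e₁ u (ι y')
    via-b y' j with ν-ends j
    ... | inj₁ (eq , _)      = ⊥-elim (x'≢a' eq)
    ... | inj₂ (refl , refl) = subst (λ z → Joins G e₂ z u) (sym ιb) (Joins-sym G j₂) , subst (Joins G e₁ u) (sym ιa) j₁

  vertices-H : ∀ ds → map proj₁ (map EH.image ds) ≡ map proj₁ ds
  vertices-H ds = trans (EH.vertices-image ds) (map-id (map proj₁ ds))

  u∉vertices-G : ∀ ds → All (u ≢_) (map proj₁ (map EG.image ds))
  u∉vertices-G ds = subst (All _) (sym (EG.vertices-image ds)) (All-≢-map ι (map proj₁ ds) (λ y eq → ι≢u y (sym eq)))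

  incident∉edges-G : ∀ {e} → Incident G e → ∀ ds → All (e ≢_) (map proj₂ (map EG.image ds))
  incident∉edges-G inc ds = subst (All _) (sym (EG.edges-image ds))
    (All-≢-map (emb G) (map proj₂ ds) (λ d eq → emb-not-incident G d (subst (Incident G) eq inc)))

  ν∉edges-H : ∀ ds → All (ν ≢_) (map proj₂ (map EH.image ds))
  ν∉edges-H ds = subst (All _) (sym (EH.edges-image ds))
    (All-≢-map embD (map proj₂ ds) (λ d eq → old≢new D (a' , b') d (sym eq)))

  vertex∉-H⇒G : ∀ {x'} ds → All (x' ≢_) (map proj₁ (map EH.image ds)) → All (ι x' ≢_) (map proj₁ (map EG.image ds))
  vertex∉-H⇒G ds al = subst (All _) (sym (EG.vertices-image ds))
    (AllP.map⁺ (All.map (λ x'≢y → x'≢y ∘ ι-injective) (subst (All _) (vertices-H ds) al)))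

  Unique-vertices-H⇒G : ∀ ds → Unique (map proj₁ (map EH.image ds)) → Unique (map proj₁ (map EG.image ds))
  Unique-vertices-H⇒G ds = EG.Unique-vertices→ ds ∘ EH.Unique-vertices← ds

  Unique-edges-H⇒G : ∀ ds → Unique (map proj₂ (map EH.image ds)) → Unique (map proj₂ (map EG.image ds))
  Unique-edges-H⇒G ds = EG.Unique-edges→ ds ∘ EH.Unique-edges← ds

  Unique-edges-G⇒H : ∀ ds → Unique (map proj₂ (map EG.image ds)) → Unique (map proj₂ (map EH.image ds))
  Unique-edges-G⇒H ds = EH.Unique-edges→ ds ∘ EG.Unique-edges← ds

  from-D-in-H : ∀ ps → All (λ q → ν ≢ proj₂ q) ps → All (λ q → Σ (Step D) λ dq → EH.image dq ≡ q) ps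
  from-D-in-H [] [] = []
  from-D-in-H ((x' , e') ∷ ps) (ne ∷ al) with old-or-new D (a' , b') e'
  ... | inj₁ (d , eq) = ((x' , d) , cong (x' ,_) eq) ∷ from-D-in-H ps al
  ... | inj₂ eq       = ⊥-elim (ne (sym eq))

  from-D-in-G : ∀ (ps : List (Step G)) → All (λ q → proj₁ q ≢ u) ps → All (λ q → ¬ Incident G (proj₂ q)) ps →
    All (λ q → Σ (Step D) λ dq → EG.image dq ≡ q) ps
  from-D-in-G [] [] [] = []
  from-D-in-G ((x , e) ∷ ps) (x≢u ∷ a₁) (ni ∷ a₂) with u-or-ι x | emb-or-incident G e
  ... | inj₁ eq | _ = ⊥-elim (x≢u eq)
  ... | inj₂ _ | inj₂ i = ⊥-elim (ni i)
  ... | inj₂ (x' , refl) | inj₁ (d , refl) = ((x' , d) , refl) ∷ from-D-in-G ps a₁ a₂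

  avoids-incident : ∀ p qs h → h ≢ u → All (λ q → proj₁ q ≢ u) (p ∷ qs) → Links G p qs h →
    All (λ q → ¬ Incident G (proj₂ q)) (p ∷ qs)
  avoids-incident (v , e) [] h h≢u (v≢u ∷ []) l = not-incident l v≢u h≢u ∷ []
  avoids-incident (v , e) ((w , f) ∷ qs) h h≢u (v≢u ∷ al@(w≢u ∷ _)) (j , l) =
    not-incident j v≢u w≢u ∷ avoids-incident (w , f) qs h h≢u al l

  module Matching (WG : Fin (suc n) → Set) (WH : Fin n → Set)
    (toG : ∀ {w} → WH w → WG (ι w)) (toH : ∀ {w} → WG (ι w) → WH w) where

    -- ν is usable in H[WH] only if the walk a-u-b is usable in G[WG].
    Compatible : Set
    Compatible = WG u ⊎ (¬ WG a ⊎ ¬ WG b)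

    u-present : Compatible → WG a → WG b → WG u
    u-present (inj₁ w)         _  _  = w
    u-present (inj₂ (inj₁ ¬a)) wa _  = ⊥-elim (¬a wa)
    u-present (inj₂ (inj₂ ¬b)) _  wb = ⊥-elim (¬b wb)

    ReachG : Fin (suc n) → Fin (suc n) → Set
    ReachG = Reach G WG (AllEdges G)
    ReachH : Fin n → Fin n → Set
    ReachH = Reach H WH (AllEdges H)

    reach-H⇒G : Compatible → ∀ {x' y'} → ReachH x' y' → ReachG (ι x') (ι y')
    reach-H⇒G C here = here
    reach-H⇒G C (step e' _ wx wy j p) with old-or-new D (a' , b') e'
    ... | inj₁ (d , refl) = step (emb G d) tt (toG wx) (toG wy) (EG.Joins→ (EH.Joins← j)) (reach-H⇒G C p)
    ... | inj₂ refl with ν-ends j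
    ...   | inj₁ (refl , refl) =
            let wu = u-present C (subst WG ιa (toG wx)) (subst WG ιb (toG wy)) in
            step e₁ tt (toG wx) wu (subst (λ z → Joins G e₁ z u) (sym ιa) (Joins-sym G j₁))
              (step e₂ tt wu (toG wy) (subst (Joins G e₂ u) (sym ιb) j₂) (reach-H⇒G C p))
    ...   | inj₂ (refl , refl) =
            let wu = u-present C (subst WG ιa (toG wy)) (subst WG ιb (toG wx)) in
            step e₂ tt (toG wx) wu (subst (λ z → Joins G e₂ z u) (sym ιb) (Joins-sym G j₂))
              (step e₁ tt wu (toG wy) (subst (Joins G e₁ u) (sym ιa) j₁) (reach-H⇒G C p))

    -- Walks of G between vertices other than u give walks of H: a visit to u
    -- enters and leaves by e₁ and e₂ (replaced by ν) or by one edge (dropped).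
    mutual
      reach-G⇒H : ∀ {s t} → ReachG s t → ∀ x' y' → s ≡ ι x' → t ≡ ι y' → ReachH x' y'
      reach-G⇒H here x' y' refl eqt = subst (ReachH x') (ι-injective eqt) here
      reach-G⇒H (step {y = y} e _ ws wy j p) x' y' refl eqt with u-or-ι y
      ... | inj₁ refl = reach-via-u p e j ws y' eqt
      ... | inj₂ (z' , refl) with emb-or-incident G e
      ...   | inj₂ i = ⊥-elim (not-incident j (ι≢u x') (ι≢u z') i)
      ...   | inj₁ (d , refl) =
              step (embD d) tt (toH ws) (toH wy) (EH.Joins→ (EG.Joins← j)) (reach-G⇒H p z' y' refl eqt)

      reach-via-u : ∀ {t} → ReachG u t → ∀ {x'} (e : Edge G) → Joins G e (ι x') u → WG (ι x') →
        ∀ y' → t ≡ ι y' → ReachH x' y'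
      reach-via-u here e je wx y' eqt = ⊥-elim (ι≢u y' (sym eqt))
      reach-via-u (step {y = z} f _ wu wz jf q) {x'} e je wx y' eqt
        with edge-at-u jf refl | edge-at-u (Joins-sym G je) refl
      ... | inj₁ (refl , refl) | inj₁ (refl , ex) = reach-G⇒H q x' y' (sym ex) eqt
      ... | inj₂ (refl , refl) | inj₂ (refl , ex) = reach-G⇒H q x' y' (sym ex) eqt
      ... | inj₁ (refl , refl) | inj₂ (refl , ex) =
            step ν tt (toH wx) (toH (subst WG (sym ιa) wz))
              (subst (λ w → Joins H ν w a') (sym (ι-injective (trans ex (sym ιb)))) ν-b'a')
              (reach-G⇒H q a' y' (sym ιa) eqt)
      ... | inj₂ (refl , refl) | inj₁ (refl , ex) =
            step ν tt (toH wx) (toH (subst WG (sym ιb) wz))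
              (subst (λ w → Joins H ν w b') (sym (ι-injective (trans ex (sym ιa)))) ν-a'b')
              (reach-G⇒H q b' y' (sym ιb) eqt)

    comp-G⇒H : ∀ {w p} → InComp G WG (ι w) (ι p) → InComp H WH w p
    comp-G⇒H {w} {p} (x , y) = toH x , reach-G⇒H y w p refl refl

    comp-H⇒G : Compatible → ∀ {w p} → InComp H WH w p → InComp G WG (ι w) (ι p)
    comp-H⇒G C (x , y) = toG x , reach-H⇒G C y

    -- For the component of w, delete the old edges deleted in G, and ν if
    -- e₁ or e₂ was deleted and both a and b are present.
    module Forward (WG? : ∀ v → Dec (WG v)) (C : Compatible) (r : ℕ) (pf : IsRPseudoforest G r WG)
      (w : Fin n) (hw : WH w) where

      F : Subset (length G)
      F = proj₁ (pf (ι w) (toG hw))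

      F≤r : ∣ F ∣ ≤ r
      F≤r = proj₁ (proj₂ (pf (ι w) (toG hw)))

      F-ends : ∀ e → e ∈ F → InComp G WG (ι w) (proj₁ (ends G e)) × InComp G WG (ι w) (proj₂ (ends G e))
      F-ends = proj₁ (proj₂ (proj₂ (pf (ι w) (toG hw))))

      acyclic : ¬ Cycle G (InComp G WG (ι w)) (λ e → e ∉ F)
      acyclic = proj₂ (proj₂ (proj₂ (pf (ι w) (toG hw))))

      CompG : Fin (suc n) → Set
      CompG = InComp G WG (ι w)
      CompH : Fin n → Set
      CompH = InComp H WH w

      inF : Edge G → Bool
      inF = lookup F

      ν-deleted : Bool
      ν-deleted = (inF e₁ ∨ inF e₂) ∧ (isYes (WG? a) ∧ isYes (WG? b))

      inF'-by-kind : (e' : Edge H) → (Σ (Edge D) λ d → embD d ≡ e') ⊎ e' ≡ ν → Bool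
      inF'-by-kind e' (inj₁ (d , _)) = inF (emb G d)
      inF'-by-kind e' (inj₂ _)       = ν-deleted

      inF' : Edge H → Bool
      inF' e' = inF'-by-kind e' (old-or-new D (a' , b') e')

      F' : Subset (length H)
      F' = tabulate inF'

      inF'-old : ∀ d → lookup F' (embD d) ≡ inF (emb G d)
      inF'-old d rewrite lookup∘tabulate inF' (embD d) with old-or-new D (a' , b') (embD d)
      ... | inj₁ (d' , eq) = cong (inF ∘ emb G) (old-injective D (a' , b') eq)
      ... | inj₂ eq        = ⊥-elim (old≢new D (a' , b') d eq)

      inF'-ν : lookup F' ν ≡ ν-deleted
      inF'-ν rewrite lookup∘tabulate inF' ν with old-or-new D (a' , b') ν
      ... | inj₁ (d' , eq) = ⊥-elim (old≢new D (a' , b') d' eq)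
      ... | inj₂ _         = refl

      ν≤F-at-u : bit ν-deleted ≤ count (λ e → inF e ∧ incident? G u e)
      ν≤F-at-u = bit≤count ν-deleted _ witness
        where
        witness : ν-deleted ≡ true → Σ (Edge G) λ e → inF e ∧ incident? G u e ≡ true
        witness h with ∨-true (inF e₁) (inF e₂) (proj₁ (∧-true _ _ h))
        ... | inj₁ t = e₁ , cong₂ _∧_ t (incident⇒true G incident-e₁)
        ... | inj₂ t = e₂ , cong₂ _∧_ t (incident⇒true G incident-e₂)

      F'≤r : ∣ F' ∣ ≤ r
      F'≤r = begin
        ∣ F' ∣                                          ≡⟨ ∣∣≡count F' ⟩
        count (lookup F')                               ≡⟨ count-append D (a' , b') (lookup F') ⟩
        count (lookup F' ∘ embD) + bit (lookup F' ν)    ≡⟨ cong₂ _+_ (count-cong inF'-old) (cong bit inF'-ν) ⟩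
        count (inF ∘ emb G) + bit ν-deleted             ≤⟨ +-mono-≤ ≤-refl ν≤F-at-u ⟩
        count (inF ∘ emb G) + count (λ e → inF e ∧ incident? G u e) ≡⟨ sym (count-deleteVertex G inF) ⟩
        count inF                                       ≡⟨ sym (∣∣≡count F) ⟩
        ∣ F ∣                                           ≤⟨ F≤r ⟩
        r                                               ∎
        where open ≤-Reasoning

      comp-u : ∀ {e c} → Joins G e u c → CompG (proj₁ (ends G e)) × CompG (proj₂ (ends G e)) → CompG u
      comp-u (inj₁ eq) (x , y) = subst CompG (cong proj₁ eq) x
      comp-u (inj₂ eq) (x , y) = subst CompG (cong proj₂ eq) y

      -- F' lies in the component of w: old edges by the walk correspondence,
      -- ν because a deleted e₁ or e₂ brings u, hence a and b, into it
      F'-ends : ∀ e' → e' ∈ F' → CompH (proj₁ (ends H e')) × CompH (proj₂ (ends H e'))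
      F'-ends e' e'∈F' with old-or-new D (a' , b') e' | trans (sym (lookup∘tabulate inF' e')) (∈⇒true e'∈F')
      ... | inj₁ (d , refl) | t =
        let (x , y) = F-ends (emb G d) (true⇒∈ t) in
        subst (CompH ∘ proj₁) (sym (ends-embD d)) (comp-G⇒H (subst (CompG ∘ proj₁) (ends-emb G d) x)) ,
        subst (CompH ∘ proj₂) (sym (ends-embD d)) (comp-G⇒H (subst (CompG ∘ proj₂) (ends-emb G d) y))
      ... | inj₂ refl | t =
        let (t₁₂ , tab) = ∧-true _ _ t
            (ta , tb)   = ∧-true _ _ tab
            wa = isYes-sound (WG? a) ta
            wb = isYes-sound (WG? b) tb
            (wu , u-reach) = [ (λ t₁ → comp-u j₁ (F-ends e₁ (true⇒∈ t₁))) ,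
                               (λ t₂ → comp-u j₂ (F-ends e₂ (true⇒∈ t₂))) ]′ (∨-true (inF e₁) (inF e₂) t₁₂)
            ca = comp-G⇒H (subst CompG (sym ιa) (wa , Reach-snoc G u-reach e₁ tt wu wa j₁))
            cb = comp-G⇒H (subst CompG (sym ιb) (wb , Reach-snoc G u-reach e₂ tt wu wb j₂))
        in subst (CompH ∘ proj₁) (sym ends-ν) ca , subst (CompH ∘ proj₂) (sym ends-ν) cb

      AvoidH : Step H → Set
      AvoidH = Inside H CompH (λ e → e ∉ F')

      AvoidG : Step G → Set
      AvoidG = Inside G CompG (λ e → e ∉ F)

      avoid-D : ∀ {dq} → AvoidH (EH.image dq) → AvoidG (EG.image dq)
      avoid-D {x , d} (c , d∉F') = comp-H⇒G C c , λ e∈F → d∉F' (true⇒∈ (trans (inF'-old d) (∈⇒true e∈F)))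

      e₁e₂-kept : ν ∉ F' → WG a → WG b → e₁ ∉ F × e₂ ∉ F
      e₁e₂-kept ν∉F' wa wb =
        let h = trans (sym (cong ((inF e₁ ∨ inF e₂) ∧_) (cong₂ _∧_ (isYes-true (WG? a) wa) (isYes-true (WG? b) wb))))
                      (trans (sym inF'-ν) (∉⇒false ν∉F'))
            (f₁ , f₂) = ∨-false (inF e₁) (inF e₂) (trans (sym (∧-identityʳ _)) h)
        in false⇒∉ f₁ , false⇒∉ f₂

      after-ν : ∀ x' ds → Links H (x' , ν) (map EH.image ds) x' → All AvoidH ((x' , ν) ∷ map EH.image ds) →
        Σ (Fin n) λ y' → Joins H ν x' y' × CompH y'
      after-ν x' []              l       (p ∷ _)     = x' , l , proj₁ p
      after-ν x' ((y' , d) ∷ ds) (j , _) (_ ∷ p ∷ _) = y' , j , proj₁ p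

      ν-ends-present : ∀ {x' y'} → Joins H ν x' y' → WH x' → WH y' → WG a × WG b
      ν-ends-present j wx wy with ν-ends j
      ... | inj₁ (refl , refl) = subst WG ιa (toG wx) , subst WG ιb (toG wy)
      ... | inj₂ (refl , refl) = subst WG ιa (toG wy) , subst WG ιb (toG wx)

      Both-kept : ∀ {eα eβ} → Both eα eβ → e₁ ∉ F × e₂ ∉ F → eα ∉ F × eβ ∉ F
      Both-kept (inj₁ (refl , refl)) (k₁ , k₂) = k₁ , k₂
      Both-kept (inj₂ (refl , refl)) (k₁ , k₂) = k₂ , k₁

      expand-ν : ∀ x' ds → IsCyclicList H AvoidH ((x' , ν) ∷ map EH.image ds) → CyclicList G AvoidG
      expand-ν x' ds (l , (x'∉ ∷ uds) , (_ ∷ ueds) , (px ∷ prest))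
        with after-ν x' ds l (px ∷ prest) | expand x'
      ... | y' , jν , cy | eα , eβ , both , via-u =
        (ι x' , eα) ∷ (u , eβ) ∷ map EG.image ds ,
        (jα , links ds l) ,
        (ι≢u x' ∷ vertex∉-H⇒G ds x'∉) ∷ (u∉vertices-G ds ∷ Unique-vertices-H⇒G ds uds) ,
        (eα≢eβ ∷ incident∉edges-G incα ds) ∷ (incident∉edges-G incβ ds ∷ Unique-edges-H⇒G ds ueds) ,
        (cx , proj₁ kept) ∷ (cu , proj₂ kept) ∷ AllP.map⁺ (All.map avoid-D (AllP.map⁻ prest))
        where
        incα : Incident G eα
        incα = proj₁ (Both-facts both)
        incβ : Incident G eβ
        incβ = proj₁ (proj₂ (Both-facts both))
        eα≢eβ : eα ≢ eβ
        eα≢eβ = proj₂ (proj₂ (Both-facts both))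
        jα : Joins G eα (ι x') u
        jα = proj₁ (via-u y' jν)
        wab : WG a × WG b
        wab = ν-ends-present jν (proj₁ (proj₁ px)) (proj₁ cy)
        wu : WG u
        wu = u-present C (proj₁ wab) (proj₂ wab)
        cx : CompG (ι x')
        cx = comp-H⇒G C (proj₁ px)
        cu : CompG u
        cu = wu , Reach-snoc G (proj₂ cx) eα tt (proj₁ cx) wu jα
        kept : eα ∉ F × eβ ∉ F
        kept = Both-kept both (e₁e₂-kept (proj₂ px) (proj₁ wab) (proj₂ wab))
        links : ∀ ds → Links H (x' , ν) (map EH.image ds) x' → Links G (u , eβ) (map EG.image ds) (ι x')
        links []        l       = proj₂ (via-u x' l)
        links (dq ∷ ds) (j , l) = proj₂ (via-u (proj₁ dq) j) , EG.Links→ dq ds x' (EH.Links← dq ds x' l)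

      cycle-H⇒G : ∀ ps → IsCyclicList H AvoidH ps → CyclicList G AvoidG
      cycle-H⇒G ps c with Any-or-none (λ q → proj₂ q ≟ ν) ps
      ... | inj₂ no-ν =
        let (ds , eq) = preimage EH.image ps (from-D-in-H ps (All.map (λ ne eq → ne (sym eq)) no-ν))
        in map EG.image ds ,
           EG.cyclic→ ds (IsCyclicList-map D avoid-D ds (EH.cyclic← ds (subst (IsCyclicList H AvoidH) (sym eq) c)))
      ... | inj₁ has-ν with bring-to-front H ps c has-ν
      ...   | (x' , _) , ys , c' , refl =
        let (ds , eq) = preimage EH.image ys (from-D-in-H ys (AllP.map⁻ (ν∉ (proj₁ (proj₂ (proj₂ c'))))))
        in expand-ν x' ds (subst (λ l → IsCyclicList H AvoidH ((x' , ν) ∷ l)) (sym eq) c')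
        where
        ν∉ : ∀ {ys} → Unique (ν ∷ map proj₂ ys) → All (ν ≢_) (map proj₂ ys)
        ν∉ (ν∉ys ∷ _) = ν∉ys

      acyclic' : ¬ Cycle H CompH (λ e → e ∉ F')
      acyclic' c = acyclic (list⇒cycle G (cycle-H⇒G (proj₁ (cycle⇒list H c)) (proj₂ (cycle⇒list H c))))

      result : PseudoforestAt H r WH w
      result = F' , F'≤r , F'-ends , acyclic'

    -- For the component of ι w, delete the
    -- old edges deleted in H, and e₁ if ν was deleted.
    module Backward (wu : WG u) (r : ℕ) (pf : IsRPseudoforest H r WH) where

      C : Compatible
      C = inj₁ wu

      module At (w : Fin n) (hw : WG (ι w)) where

        F' : Subset (length H)
        F' = proj₁ (pf w (toH hw))

        F'≤r : ∣ F' ∣ ≤ r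
        F'≤r = proj₁ (proj₂ (pf w (toH hw)))

        F'-ends : ∀ e → e ∈ F' → InComp H WH w (proj₁ (ends H e)) × InComp H WH w (proj₂ (ends H e))
        F'-ends = proj₁ (proj₂ (proj₂ (pf w (toH hw))))

        acyclic' : ¬ Cycle H (InComp H WH w) (λ e → e ∉ F')
        acyclic' = proj₂ (proj₂ (proj₂ (pf w (toH hw))))

        CompG : Fin (suc n) → Set
        CompG = InComp G WG (ι w)
        CompH : Fin n → Set
        CompH = InComp H WH w

        inF' : Edge H → Bool
        inF' = lookup F'

        inF-by-kind : (e : Edge G) → (Σ (Edge D) λ d → emb G d ≡ e) ⊎ Incident G e → Bool
        inF-by-kind e (inj₁ (d , _)) = inF' (embD d)
        inF-by-kind e (inj₂ _)       = inF' ν ∧ isYes (e ≟ e₁)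

        inF : Edge G → Bool
        inF e = inF-by-kind e (emb-or-incident G e)

        F : Subset (length G)
        F = tabulate inF

        inF-old : ∀ d → inF (emb G d) ≡ inF' (embD d)
        inF-old d with emb-or-incident G (emb G d)
        ... | inj₁ (d' , eq) = cong (inF' ∘ embD) (emb-injective G eq)
        ... | inj₂ i         = ⊥-elim (emb-not-incident G d i)

        inF-incident : ∀ {e} → Incident G e → inF e ≡ inF' ν ∧ isYes (e ≟ e₁)
        inF-incident {e} i with emb-or-incident G e
        ... | inj₁ (d , refl) = ⊥-elim (emb-not-incident G d i)
        ... | inj₂ _          = refl

        inF-e₁ : inF e₁ ≡ inF' ν
        inF-e₁ rewrite inF-incident incident-e₁ | isYes-true (e₁ ≟ e₁) refl = ∧-identityʳ (inF' ν)

        F-at-u≤ν : count (λ e → inF e ∧ incident? G u e) ≤ bit (inF' ν)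
        F-at-u≤ν = ≤-trans (count-mono only-e₁) (count-single (inF' ν) e₁)
          where
          only-e₁ : ∀ e → inF e ∧ incident? G u e ≡ true → inF' ν ∧ isYes (e ≟ e₁) ≡ true
          only-e₁ e t = let (t₁ , t₂) = ∧-true (inF e) _ t in trans (sym (inF-incident (true⇒incident G t₂))) t₁

        F≤r : ∣ F ∣ ≤ r
        F≤r = begin
          ∣ F ∣                                                      ≡⟨ ∣tabulate∣≡count inF ⟩
          count inF                                                  ≡⟨ count-deleteVertex G inF ⟩
          count (inF ∘ emb G) + count (λ e → inF e ∧ incident? G u e) ≤⟨ +-mono-≤ (≤-reflexive (count-cong inF-old)) F-at-u≤ν ⟩
          count (inF' ∘ embD) + bit (inF' ν)                         ≡⟨ sym (count-append D (a' , b') inF') ⟩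
          count inF'                                                 ≡⟨ sym (∣∣≡count F') ⟩
          ∣ F' ∣                                                     ≤⟨ F'≤r ⟩
          r                                                          ∎
          where open ≤-Reasoning

        -- F lies in the component of ι w: old edges by the walk correspondence,
        -- e₁ because ν ∈ F' brings a, hence u, into it
        F-ends : ∀ e → e ∈ F → CompG (proj₁ (ends G e)) × CompG (proj₂ (ends G e))
        F-ends e e∈F with emb-or-incident G e | trans (sym (lookup∘tabulate inF e)) (∈⇒true e∈F)
        ... | inj₁ (d , refl) | t =
          let (x , y) = F'-ends (embD d) (true⇒∈ t) in
          subst (CompG ∘ proj₁) (sym (ends-emb G d)) (comp-H⇒G C (subst (CompH ∘ proj₁) (ends-embD d) x)) ,
          subst (CompG ∘ proj₂) (sym (ends-emb G d)) (comp-H⇒G C (subst (CompH ∘ proj₂) (ends-embD d) y))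
        ... | inj₂ i | t with ∧-true (inF' ν) _ t
        ...   | t₁ , t₂ with isYes-sound (e ≟ e₁) t₂
        ...     | refl =
          let ca = subst CompG ιa (comp-H⇒G C (subst (CompH ∘ proj₁) ends-ν (proj₁ (F'-ends ν (true⇒∈ t₁)))))
              cu = wu , Reach-snoc G (proj₂ ca) e₁ tt (proj₁ ca) wu (Joins-sym G j₁)
          in Joins-ends G {CompG} j₁ cu ca

        AvoidG : Step G → Set
        AvoidG = Inside G CompG (λ e → e ∉ F)

        AvoidH : Step H → Set
        AvoidH = Inside H CompH (λ e → e ∉ F')

        avoid-D : ∀ {dq} → AvoidG (EG.image dq) → AvoidH (EH.image dq)
        avoid-D {x , d} (c , d∉F) = comp-G⇒H c , λ e∈F' → d∉F (true⇒∈ (trans (lookup∘tabulate inF (emb G d))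
                                                                     (trans (inF-old d) (∈⇒true e∈F'))))

        Unique-vertices-G⇒H : ∀ y' ds → Unique (ι y' ∷ map proj₁ (map EG.image ds)) →
          Unique (y' ∷ map proj₁ (map EH.image ds))
        Unique-vertices-G⇒H y' ds uq =
          subst (Unique ∘ (y' ∷_)) (sym (vertices-H ds))
            (UniqueP.map⁻ {f = ι} (subst (Unique ∘ (ι y' ∷_)) (EG.vertices-image ds) uq))

        shortcut-u : ∀ yv g f rest → IsCyclicList G AvoidG ((yv , g) ∷ (u , f) ∷ rest) → CyclicList H AvoidH
        shortcut-u yv g f rest ((jg , l) , ((y≢u ∷ y∉rest) ∷ (u∉rest ∷ uv)) , ((g≢f ∷ g∉rest) ∷ (f∉rest ∷ ue)) ,
                                (py ∷ pu ∷ prest))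
          with u-or-ι yv
        ... | inj₁ eq = ⊥-elim (y≢u eq)
        ... | inj₂ (y' , refl) =
          (y' , ν) ∷ map EH.image ds ,
          links ds l' ,
          Unique-vertices-G⇒H y' ds (subst (λ l → All (ι y' ≢_) (map proj₁ l)) (sym eq) y∉rest ∷
                                      subst (Unique ∘ map proj₁) (sym eq) uv) ,
          (ν∉edges-H ds ∷ Unique-edges-G⇒H ds (subst (Unique ∘ map proj₂) (sym eq) ue)) ,
          (comp-G⇒H (proj₁ py) , ν∉F') ∷ AllP.map⁺ (All.map avoid-D (AllP.map⁻ (subst (All AvoidG) (sym eq) prest)))
          where
          ig : Incident G g
          ig = Joins-u⇒incident (Joins-sym G jg)
          first-incident : ∀ rest → Links G (u , f) rest (ι y') → Incident G f
          first-incident []      l       = Joins-u⇒incident l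
          first-incident (_ ∷ _) (j , _) = Joins-u⇒incident j
          if : Incident G f
          if = first-incident rest l
          rest-not-incident : All (λ q → ¬ Incident G (proj₂ q)) rest
          rest-not-incident = AllP.map⁻ (All.zipWith
            (λ { (g≢e , f≢e) ie → [ g≢e ∘ sym , f≢e ∘ sym ]′ (incident-pair ig if g≢f ie) }) (g∉rest , f∉rest))
          rest-not-u : All (λ q → proj₁ q ≢ u) rest
          rest-not-u = AllP.map⁻ (All.map (λ u≢ eq → u≢ (sym eq)) u∉rest)
          pre : Σ (List (Step D)) λ ds → map EG.image ds ≡ rest
          pre = preimage EG.image rest (from-D-in-G rest rest-not-u rest-not-incident)
          ds : List (Step D)
          ds = proj₁ pre
          eq : map EG.image ds ≡ rest
          eq = proj₂ pre
          l' : Links G (u , f) (map EG.image ds) (ι y')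
          l' = subst (λ l → Links G (u , f) l (ι y')) (sym eq) l
          links : ∀ ds → Links G (u , f) (map EG.image ds) (ι y') → Links H (y' , ν) (map EH.image ds) y'
          links []        l       = shortcut jg l g≢f
          links (dq ∷ ds) (j , l) = shortcut jg j g≢f , EH.Links→ dq ds y' (EG.Links← dq ds y' l)
          ν∉F' : ν ∉ F'
          ν∉F' ν∈F' with incident-pair ig if g≢f incident-e₁
          ... | inj₁ refl = proj₂ py (true⇒∈ (trans (lookup∘tabulate inF e₁) (trans inF-e₁ (∈⇒true ν∈F'))))
          ... | inj₂ refl = proj₂ pu (true⇒∈ (trans (lookup∘tabulate inF e₁) (trans inF-e₁ (∈⇒true ν∈F'))))

        cycle-G⇒H : ∀ ps → IsCyclicList G AvoidG ps → CyclicList H AvoidH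
        cycle-G⇒H ps c with Any-or-none (λ q → proj₁ q ≟ u) ps
        cycle-G⇒H (p ∷ qs) c | inj₂ no-u =
          let (ds , eq) = preimage EG.image (p ∷ qs)
                (from-D-in-G (p ∷ qs) no-u (avoids-incident p qs (proj₁ p) (All.head no-u) no-u (proj₁ c)))
          in map EH.image ds ,
             EH.cyclic→ ds (IsCyclicList-map D avoid-D ds (EG.cyclic← ds (subst (IsCyclicList G AvoidG) (sym eq) c)))
        ... | inj₁ has-u with bring-to-front G ps c has-u
        ...   | (_ , f) , rest , c' , refl with initLast rest
        ...     | [] with edge-at-u (proj₁ c') refl
        ...       | inj₁ (_ , u≡a) = ⊥-elim (u≢a u≡a)
        ...       | inj₂ (_ , u≡b) = ⊥-elim (u≢b u≡b)
        cycle-G⇒H ps c | inj₁ has-u | (_ , f) , _ , c' , refl | qs ∷ʳ′ (yv , g) =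
          shortcut-u yv g f qs (rotate G ((u , f) ∷ qs) (yv , g) [] c')

        acyclic : ¬ Cycle G CompG (λ e → e ∉ F)
        acyclic c = acyclic' (list⇒cycle H (cycle-G⇒H (proj₁ (cycle⇒list G c)) (proj₂ (cycle⇒list G c))))

        result : PseudoforestAt G r WG (ι w)
        result = F , F≤r , F-ends , acyclic

      isolated : ¬ WG a → ¬ WG b → ∀ {x} → Reach G WG (AllEdges G) u x → x ≡ u
      isolated ¬a ¬b here = refl
      isolated ¬a ¬b (step e _ _ wy j p) with edge-at-u j refl
      ... | inj₁ (_ , refl) = ⊥-elim (¬a wy)
      ... | inj₂ (_ , refl) = ⊥-elim (¬b wy)

      -- the component of u is that of a present neighbour, or {u} itself
      result : (∀ v → Dec (WG v)) → IsRPseudoforest G r WG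
      result WG? v wv with u-or-ι v
      ... | inj₂ (w , refl) = At.result w wv
      ... | inj₁ refl with WG? a | WG? b
      ...   | yes wa | _ = PseudoforestAt-reach G r WG
                (subst (PseudoforestAt G r WG) ιa (At.result a' (subst WG (sym ιa) wa))) (step e₁ tt wu wa j₁ here)
      ...   | no _ | yes wb = PseudoforestAt-reach G r WG
                (subst (PseudoforestAt G r WG) ιb (At.result b' (subst WG (sym ιb) wb))) (step e₂ tt wu wb j₂ here)
      ...   | no ¬a | no ¬b = ∅ , ≤-trans (≤-reflexive (∣⊥∣≡0 (length G))) z≤n , (λ e e∈∅ → ⊥-elim (∉⊥ e∈∅)) , no-cycle
        where
        -- a cycle in {u} would be a loop at u
        no-cycle : ¬ Cycle G (InComp G WG u) (λ e → e ∉ ∅)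
        no-cycle c with isolated ¬a ¬b (proj₂ (vs-in zero)) | isolated ¬a ¬b (proj₂ (vs-in (csuc zero))) | joins zero
          where open Cycle c
        ... | p | q | j with edge-at-u (subst₂ (Joins G (Cycle.es c zero)) p q j) refl
        ...   | inj₁ (_ , u≡a) = u≢a u≡a
        ...   | inj₂ (_ , u≡b) = u≢b u≡b

  open Vertex-Sets u

  -- A deletion set X of G restricts to one of H, provided u ∉ X or an end of
  -- ν is in X (otherwise ν could close a cycle that in G runs through u).
  restrict-deletion-set : ∀ r X → u ∉ X ⊎ (a ∈ X ⊎ b ∈ X) →
    IsRPFDeletionSet G r X → IsRPFDeletionSet H r (restrict u X)
  restrict-deletion-set r X cond pf = Forward.result (λ v → ¬? (v ∈? X)) compatible r pf
    where
    open Matching (_∉ X) (_∉ restrict u X) (λ w∉ → w∉ ∘ restrict-∈⁺) (λ ιw∉ → ιw∉ ∘ restrict-∈⁻)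
    compatible : Compatible
    compatible = ⊎-map₂ (⊎-map (λ a∈ a∉ → a∉ a∈) (λ b∈ b∉ → b∉ b∈)) cond

  lift-deletion-set : ∀ r X' → IsRPFDeletionSet H r X' → IsRPFDeletionSet G r (lift X')
  lift-deletion-set r X' pf = Backward.result (u∉lift X') r pf (λ v → ¬? (v ∈? lift X'))
    where open Matching (_∉ lift X') (_∉ X') (λ w∉ → w∉ ∘ lift-∈⁻) (λ ιw∉ → ιw∉ ∘ lift-∈⁺)

  module _ (S : Subset (suc n)) (k r : ℕ) where

    -- A solution of G gives one of H: restrict it, after trading u for a
    -- neighbour c ∉ S if u was deleted.
    solution-G⇒H : a ∉ S ⊎ b ∉ S → YesInstance G S k r → YesInstance H (restrict u S) k r
    solution-G⇒H ab∉S (X , pfX , X≤k , X∩S=∅) with u ∈? X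
    ... | no u∉X =
      restrict u X , restrict-deletion-set r X (inj₁ u∉X) pfX ,
      ≤-trans (≤-trans (m≤n+m _ _) (≤-reflexive (sym (∣restrict∣ X)))) X≤k ,
      restrict-disjoint X∩S=∅
    ... | yes u∈X =
      restrict u Y , restrict-deletion-set r Y (inj₂ a∈Y⊎b∈Y) pfY , Y≤k , restrict-disjoint Y∩S=∅
      where
      neighbour : Σ (Fin (suc n)) λ c → c ∉ S × (c ≡ a ⊎ c ≡ b)
      neighbour = [ (λ a∉S → a , a∉S , inj₁ refl) , (λ b∉S → b , b∉S , inj₂ refl) ]′ ab∉S
      c : Fin (suc n)
      c = proj₁ neighbour
      Y : Subset (suc n)
      Y = add X c
      pfY : IsRPFDeletionSet G r Y
      pfY = IsRPseudoforest-mono G r (_∉ X) (_∉ Y) (λ v∉Y → v∉Y ∘ ⊆add X c) (λ v → ¬? (v ∈? Y)) pfX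
      a∈Y⊎b∈Y : a ∈ Y ⊎ b ∈ Y
      a∈Y⊎b∈Y = ⊎-map (λ c≡a → subst (_∈ Y) c≡a (c∈add X c)) (λ c≡b → subst (_∈ Y) c≡b (c∈add X c))
                      (proj₂ (proj₂ neighbour))
      Y∩S=∅ : ∀ v → v ∈ Y → v ∉ S
      Y∩S=∅ v v∈Y with ∈add⁻ X c v∈Y
      ... | inj₁ v∈X = X∩S=∅ v v∈X
      ... | inj₂ refl = proj₁ (proj₂ neighbour)
      -- u ∈ Y, so restricting Y loses one vertex, making up for adding c
      Y≤k : ∣ restrict u Y ∣ ≤ k
      Y≤k = ≤-trans (s≤s⁻¹ (begin
        suc ∣ restrict u Y ∣                ≡⟨ cong (λ x → bit x + ∣ restrict u Y ∣) (sym (∈⇒true (⊆add X c u∈X))) ⟩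
        bit (lookup Y u) + ∣ restrict u Y ∣ ≡⟨ sym (∣restrict∣ Y) ⟩
        ∣ Y ∣                               ≤⟨ ∣add∣ X c ⟩
        suc ∣ X ∣                           ∎)) X≤k
        where open ≤-Reasoning

    solution-H⇒G : YesInstance H (restrict u S) k r → YesInstance G S k r
    solution-H⇒G (X' , pfX' , X'≤k , X'∩S=∅) =
      lift X' , lift-deletion-set r X' pfX' , ≤-trans (≤-reflexive (∣lift∣ X')) X'≤k , disjoint
      where
      disjoint : ∀ v → v ∈ lift X' → v ∉ S
      disjoint v v∈ with u-or-ι v
      ... | inj₁ refl       = ⊥-elim (u∉lift X' v∈)
      ... | inj₂ (w , refl) = λ ιw∈S → X'∩S=∅ w (lift-∈⁻ v∈) (restrict-∈⁺ ιw∈S)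

-- The theorem: bypassing a degree-two vertex u ∉ S with a neighbour outside
-- S preserves the answer.  (The hypotheses that S is a deletion set of size
-- at most k + 1 and that u ∉ S are part of the problem but not needed.)
lemma1 : ∀ {n} (G : Graph (suc n)) (S : Subset (suc n)) (k r : ℕ) →
    IsRPFDeletionSet G r S → ∣ S ∣ ≤ suc k →
    (u a b : Fin (suc n)) → u ∉ S → degree G u ≡ 2 →
    (e₁ e₂ : Edge G) → e₁ ≢ e₂ → Joins G e₁ u a → Joins G e₂ u b →
    (u≢a : u ≢ a) (u≢b : u ≢ b) → (a ∉ S ⊎ b ∉ S) →
    YesInstance G S k r ⇔ YesInstance (bypass G u a b u≢a u≢b) (restrict u S) k r
lemma1 G S k r _ _ u a b _ deg e₁ e₂ e₁≢e₂ j₁ j₂ u≢a u≢b ab∉S =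
  mk⇔ (solution-G⇒H S k r ab∉S) (solution-H⇒G S k r)
  where open Bypass G u a b e₁ e₂ e₁≢e₂ j₁ j₂ u≢a u≢b deg
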